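{- Assume the following statement (H) holds: for every integer $\ell\ge 1$, every $n$ with $2^n\ge\ell$, and every set $S\subseteq\mathbb{F}_2^n$ of $\ell$ cards that is not contained in any complete set of $2^{\lceil\log_2\ell\rceil}$ cards of $\mathbb{F}_2^n$, the number of quads in $S$ is at most $Q(\ell-1)$. Then for every integer $\ell\ge 0$, the number of quads in an $\ell$-packed set equals $F(\ell)$, i.e. $Q(\ell)=F(\ell)$.
   Context: An EvenQuads deck of size $2^n$ is the set $\mathbb{F}_2^n$; its elements are called cards. A quad is a $4$-element subset $\{a,b,c,d\}$ of the deck with $a+b+c+d=0$. The number of quads in a set of cards is the number of its $4$-element subsets that are quads. A set $S$ of cards is complete if for any three distinct $a,b,c\in S$ the card $a+b+c$ also lies in $S$. For $\ell\ge 0$, $Q(\ell)$ is the maximum, over all $n$ with $2^n\ge\ell$ and all $\ell$-element subsets of $\mathbb{F}_2^n$, of the number of quads in the subset; an $\ell$-packed set is a set of $\ell$ cards in some deck containing exactly $Q(\ell)$ quads. The function $F:\mathbb{Z}_{\ge0}\to\mathbb{Q}$ is defined recursively by $F(0)=0$, $F(1)=0$, and, for $k\ge1$ and $2^{k-1}<p\le 2^k$, with $q=2^k-p$: \[F(p)=F(q)+\frac{3\binom{p}{3}-q\binom{p}{2}+p\binom{q}{2}-3\binom{q}{3}}{12}.\] -}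

module Defs where

open import Data.Bool using (Bool; _xor_; true; false)
open import Data.Nat using (ℕ; zero; suc; _∸_; _^_; _≤_)
open import Data.Nat.Logarithm using (⌈log₂_⌉)
open import Data.Nat.Combinatorics using (_C_)
open import Data.Integer as ℤ using (ℤ; +_)
open import Data.Rational as ℚ using (ℚ)
open import Data.Vec using (Vec; zipWith; replicate)
open import Data.List using (List; []; _∷_; length; filter; map; _++_)
open import Data.List.Membership.Propositional using (_∈_)
open import Data.List.Relation.Unary.All using (All)
open import Data.List.Relation.Unary.Unique.Propositional using (Unique)
open import Data.Product using (Σ; _×_; _,_; ∃)
open import Relation.Binary.PropositionalEquality using (_≡_; _≢_)
open import Relation.Nullary using (¬_)
open import Relation.Nullary.Decidable using (Dec)
open import Data.Vec.Properties using (≡-dec)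
open import Data.Bool.Properties using (_≟_)

Card : ℕ → Set
Card n = Vec Bool n

_⊕_ : ∀ {n} → Card n → Card n → Card n
_⊕_ = zipWith _xor_

𝟎 : ∀ {n} → Card n
𝟎 = replicate _ false

_≟c_ : ∀ {n} (a b : Card n) → Dec (a ≡ b)
_≟c_ = ≡-dec _≟_

CardSet : ℕ → Set
CardSet n = Σ (List (Card n)) Unique

elems : ∀ {n} → CardSet n → List (Card n)
elems (xs , _) = xs

size : ∀ {n} → CardSet n → ℕ
size S = length (elems S)

-- All 4-element sublists (index-increasing choices of 4 positions).
-- Since the list has no duplicates, these correspond exactly to the
-- 4-element subsets of the set.
choose : ∀ {A : Set} → ℕ → List A → List (List A)
choose zero    _        = [] ∷ []
choose (suc k) []       = []
choose (suc k) (x ∷ xs) = map (x ∷_) (choose k xs) ++ choose (suc k) xs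

sumCards : ∀ {n} → List (Card n) → Card n
sumCards []       = 𝟎
sumCards (x ∷ xs) = x ⊕ sumCards xs

quads : ∀ {n} → CardSet n → ℕ
quads S = length (filter (λ T → sumCards T ≟c 𝟎) (choose 4 (elems S)))

Complete : ∀ {n} → CardSet n → Set
Complete S = ∀ a b c → a ∈ elems S → b ∈ elems S → c ∈ elems S →
             a ≢ b → a ≢ c → b ≢ c → (a ⊕ (b ⊕ c)) ∈ elems S

_⊆ₛ_ : ∀ {n} → CardSet n → CardSet n → Set
S ⊆ₛ T = All (_∈ elems T) (elems S)

-- "Q(ℓ) = m": m is the maximum, over all n with 2^n ≥ ℓ and all ℓ-element
-- subsets S of F_2^n, of the number of quads in S (attained and an upper bound).
IsQ : ℕ → ℕ → Set
IsQ ℓ m =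
  (∃ λ n → Σ (CardSet n) λ S → ℓ ≤ 2 ^ n × size S ≡ ℓ × quads S ≡ m) ×
  (∀ n (S : CardSet n) → ℓ ≤ 2 ^ n → size S ≡ ℓ → quads S ≤ m)

-- The function F, by recursion with fuel (q < p whenever p ≥ 2, so fuel p suffices).
-- For p ≥ 2, k = ⌈log₂ p⌉ is the unique k ≥ 1 with 2^(k-1) < p ≤ 2^k, and q = 2^k - p.
Fᶠ : ℕ → ℕ → ℚ
Fᶠ zero    _             = ℚ.0ℚ
Fᶠ (suc f) zero          = ℚ.0ℚ
Fᶠ (suc f) (suc zero)    = ℚ.0ℚ
Fᶠ (suc f) p@(suc (suc _)) =
  let q = 2 ^ ⌈log₂ p ⌉ ∸ p
      num = (+ (3 ℕ* (p C 3)) ℤ.- + (q ℕ* (p C 2))) ℤ.+ (+ (p ℕ* (q C 2)) ℤ.- + (3 ℕ* (q C 3)))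
  in Fᶠ f q ℚ.+ (num ℚ./ 12)
  where open import Data.Nat renaming (_*_ to _ℕ*_)

F : ℕ → ℚ
F p = Fᶠ p p

HypH : Set
HypH = ∀ (ℓ : ℕ) → 1 ≤ ℓ → ∀ n → ℓ ≤ 2 ^ n → (S : CardSet n) → size S ≡ ℓ →
       (∀ (T : CardSet n) → size T ≡ 2 ^ ⌈log₂ ℓ ⌉ → Complete T → ¬ (S ⊆ₛ T)) →
       ∀ m → IsQ (ℓ ∸ 1) m → quads S ≤ m

-- In a complete set T (an affine subspace) any three cards lie in exactly one quad of T.
-- For T = X ⊔ Xᶜ with |X| = p and |Xᶜ| = q, sort the ordered triples of distinct cards with
-- a given number of cards in X by the side on which the fourth card of their quad lies: the
-- quads with three, two or one cards in X cancel in an alternating sum, leaving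
--   12 · quads X + φ q p = 12 · quads Xᶜ + φ p q,   where φ p q = 3 C(p,3) + p C(q,2).
-- So within a complete set of 2 ^ ⌈log₂ p⌉ cards, X has the most quads exactly when its
-- complement of q < p cards does; recursively complemented ("packed") sets achieve this, and
-- their quad counts satisfy the recursion defining F.  A set outside every such complete set
-- has at most Q(p − 1) quads by (H), and Q(p − 1) ≤ Q(p) since adding a card loses no quads.

module Submission where

open import Defs

open import Data.Bool using (false; true)
open import Data.Bool.Properties using (xor-assoc; xor-comm; xor-same; xor-identityˡ; xor-identityʳ)
open import Data.Empty using (⊥-elim)
open import Data.Integer as ℤ using (ℤ; +_)
open import Data.Integer.Properties using (pos-+; pos-*)
import Data.Integer.Tactic.RingSolver as ℤ-Solver
open import Data.List using (List; []; _∷_; length; filter; map; _++_)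
open import Data.List.Membership.Propositional using (_∈_; _∉_)
open import Data.List.Membership.Propositional.Properties using (∈-filter⁺; ∈-filter⁻; ∈-map⁺; ∈-map⁻; ∈-++⁺ˡ; ∈-++⁺ʳ)
open import Data.List.Properties using (length-++; length-map)
open import Data.List.Relation.Binary.Subset.Propositional using (_⊆_)
open import Data.List.Relation.Unary.All as All using (All; []; _∷_)
open import Data.List.Relation.Unary.AllPairs using ([]; _∷_)
open import Data.List.Relation.Unary.Any using (here; there; any?)
open import Data.List.Relation.Unary.Unique.Propositional using (Unique)
open import Data.List.Relation.Unary.Unique.Propositional.Properties using (filter⁺; map⁺; ++⁺)
open import Data.Nat using (ℕ; zero; suc; _+_; _*_; _∸_; _^_; _≤_; _<_; z≤n; s≤s; _≤?_; ⌈_/2⌉; ⌊_/2⌋; >-nonZero)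
open import Data.Nat.Combinatorics using (_C_; nCk+nC[k+1]≡[n+1]C[k+1]; nC1≡n)
open import Data.Nat.Induction using (<-rec)
open import Data.Nat.Logarithm using (⌈log₂_⌉; ⌈log₂⌉-mono-≤; ⌈log₂⌈n/2⌉⌉≡⌈log₂n⌉∸1; ⌈log₂2^n⌉≡n)
open import Data.Nat.Properties
open import Data.Nat.Tactic.RingSolver using (solve-∀)
open import Data.Product using (_×_; _,_; ∃; proj₁; proj₂)
open import Data.Rational as ℚ using (_/_)
open import Data.Rational.Properties using (fromℚᵘ-toℚᵘ; toℚᵘ-fromℚᵘ; fromℚᵘ-cong; toℚᵘ-homo-+)
import Data.Rational.Unnormalised as ℚᵘ
import Data.Rational.Unnormalised.Properties as ℚᵘ
open import Data.Sum using (inj₁; inj₂)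
open import Data.Vec using ([]; _∷_)
open import Data.Vec.Properties using (∷-injectiveʳ; zipWith-comm; zipWith-assoc; zipWith-identityˡ; zipWith-identityʳ)
open import Function using (_∘_)
open import Relation.Binary.PropositionalEquality
open import Relation.Nullary using (¬_; Dec; yes; no; ¬?)


private
  variable
    A B : Set

⊕-self : ∀ {n} (a : Card n) → a ⊕ a ≡ 𝟎
⊕-self []      = refl
⊕-self (x ∷ a) = cong₂ _∷_ (xor-same x) (⊕-self a)

module _ {n : ℕ} where

  ⊕-comm : (a b : Card n) → a ⊕ b ≡ b ⊕ a
  ⊕-comm = zipWith-comm xor-comm

  ⊕-assoc : (a b c : Card n) → (a ⊕ b) ⊕ c ≡ a ⊕ (b ⊕ c)
  ⊕-assoc = zipWith-assoc xor-assoc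

  ⊕-identityˡ : (a : Card n) → 𝟎 ⊕ a ≡ a
  ⊕-identityˡ = zipWith-identityˡ xor-identityˡ

  ⊕-identityʳ : (a : Card n) → a ⊕ 𝟎 ≡ a
  ⊕-identityʳ = zipWith-identityʳ xor-identityʳ

  ⊕-cancelˡ : (a b : Card n) → a ⊕ (a ⊕ b) ≡ b
  ⊕-cancelˡ a b = trans (sym (⊕-assoc a a b)) (trans (cong (_⊕ b) (⊕-self a)) (⊕-identityˡ b))

  ⊕-leftComm : (a b c : Card n) → a ⊕ (b ⊕ c) ≡ b ⊕ (a ⊕ c)
  ⊕-leftComm a b c = trans (sym (⊕-assoc a b c)) (trans (cong (_⊕ c) (⊕-comm a b)) (⊕-assoc b a c))

  ⊕-injectiveˡ : ∀ a {b c : Card n} → a ⊕ b ≡ a ⊕ c → b ≡ c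
  ⊕-injectiveˡ a {b} {c} e = trans (sym (⊕-cancelˡ a b)) (trans (cong (a ⊕_) e) (⊕-cancelˡ a c))

  ≡⊕⇒≡⊕ : {a b c : Card n} → a ≡ b ⊕ c → c ≡ b ⊕ a
  ≡⊕⇒≡⊕ {a} {b} {c} e = trans (sym (⊕-cancelˡ b c)) (cong (b ⊕_) (sym e))

  ⊕≡𝟎⇒≡ : {a b : Card n} → a ⊕ b ≡ 𝟎 → a ≡ b
  ⊕≡𝟎⇒≡ {a} {b} e = trans (sym (⊕-identityʳ a)) (trans (cong (a ⊕_) (sym e)) (⊕-cancelˡ a b))

  ⊕-cancelʳ : (a b : Card n) → (a ⊕ b) ⊕ b ≡ a
  ⊕-cancelʳ a b = trans (⊕-assoc a b b) (trans (cong (a ⊕_) (⊕-self b)) (⊕-identityʳ a))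

  ≡⊕-exchange : {x a d : Card n} → x ≡ a ⊕ d → a ≡ x ⊕ d
  ≡⊕-exchange {x} {a} {d} e = trans (≡⊕⇒≡⊕ (trans e (⊕-comm a d))) (⊕-comm d x)

  ⊕-rotate : {a b c d : Card n} → a ≡ b ⊕ (c ⊕ d) → d ≡ (b ⊕ a) ⊕ c
  ⊕-rotate {a} {b} {c} e = trans (≡⊕⇒≡⊕ (sym (≡⊕⇒≡⊕ e))) (⊕-comm c (b ⊕ a))

  ⊕-rotate⁻ : {a b c d : Card n} → d ≡ (b ⊕ a) ⊕ c → a ≡ b ⊕ (c ⊕ d)
  ⊕-rotate⁻ {a} {b} {c} e = ≡⊕⇒≡⊕ (sym (≡⊕⇒≡⊕ (trans e (⊕-comm (b ⊕ a) c))))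

  ≢⇒⊕≢𝟎 : {a b : Card n} → a ≢ b → b ⊕ a ≢ 𝟎
  ≢⇒⊕≢𝟎 a≢b e = a≢b (sym (⊕≡𝟎⇒≡ e))

  ≢𝟎⇒≢⊕ : {w : Card n} (a : Card n) → w ≢ 𝟎 → a ≢ w ⊕ a
  ≢𝟎⇒≢⊕ {w} a w≢𝟎 e = w≢𝟎 (⊕-injectiveˡ a (trans (⊕-comm a w) (trans (sym e) (sym (⊕-identityʳ a)))))

  a⊕[b⊕c]≡a⇒b≡c : {a b c : Card n} → a ⊕ (b ⊕ c) ≡ a → b ≡ c
  a⊕[b⊕c]≡a⇒b≡c {a} e = ⊕≡𝟎⇒≡ (⊕-injectiveˡ a (trans e (sym (⊕-identityʳ a))))

-- Kronecker deltas and sums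

⟦_⟧ : ∀ {p} {P : Set p} → Dec P → ℕ
⟦ yes _ ⟧ = 1
⟦ no _ ⟧  = 0

⟦⟧-cong : ∀ {p q} {P : Set p} {Q : Set q} (d : Dec P) (e : Dec Q) →
          (P → Q) → (Q → P) → ⟦ d ⟧ ≡ ⟦ e ⟧
⟦⟧-cong (yes p) (yes q) f g = refl
⟦⟧-cong (yes p) (no ¬q) f g = ⊥-elim (¬q (f p))
⟦⟧-cong (no ¬p) (yes q) f g = ⊥-elim (¬p (g q))
⟦⟧-cong (no ¬p) (no ¬q) f g = refl

module _ {n : ℕ} where

  δ δᶜ : Card n → Card n → ℕ
  δ a b  = ⟦ a ≟c b ⟧
  δᶜ a b = 1 ∸ δ a b

  δᶜ₃ : Card n → Card n → Card n → ℕ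
  δᶜ₃ a b c = δᶜ a b * (δᶜ a c * δᶜ b c)

  ≡⇒δ≡1 : {a b : Card n} → a ≡ b → δ a b ≡ 1
  ≡⇒δ≡1 {a} {b} a≡b with a ≟c b
  ... | yes _   = refl
  ... | no a≢b = ⊥-elim (a≢b a≡b)

  ≢⇒δ≡0 : {a b : Card n} → a ≢ b → δ a b ≡ 0
  ≢⇒δ≡0 {a} {b} a≢b with a ≟c b
  ... | yes a≡b = ⊥-elim (a≢b a≡b)
  ... | no _    = refl

  ≡⇒δᶜ≡0 : {a b : Card n} → a ≡ b → δᶜ a b ≡ 0
  ≡⇒δᶜ≡0 a≡b = cong (1 ∸_) (≡⇒δ≡1 a≡b)

  ≢⇒δᶜ≡1 : {a b : Card n} → a ≢ b → δᶜ a b ≡ 1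
  ≢⇒δᶜ≡1 a≢b = cong (1 ∸_) (≢⇒δ≡0 a≢b)

  δ-cong : {a b c d : Card n} → (a ≡ b → c ≡ d) → (c ≡ d → a ≡ b) → δ a b ≡ δ c d
  δ-cong {a} {b} {c} {d} = ⟦⟧-cong (a ≟c b) (c ≟c d)

  δ-sym : (a b : Card n) → δ a b ≡ δ b a
  δ-sym a b = δ-cong sym sym

  δᶜ-sym : (a b : Card n) → δᶜ a b ≡ δᶜ b a
  δᶜ-sym a b = cong (1 ∸_) (δ-sym a b)

  δᶜ₃-zeroˡ : (a c : Card n) → δᶜ₃ a a c ≡ 0
  δᶜ₃-zeroˡ a c rewrite ≡⇒δᶜ≡0 {a} {a} refl = refl

  δᶜ₃-zeroᵐ : (a b : Card n) → δᶜ₃ a b a ≡ 0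
  δᶜ₃-zeroᵐ a b rewrite ≡⇒δᶜ≡0 {a} {a} refl = *-zeroʳ (δᶜ a b)

  δᶜ₃-zeroʳ : (a b : Card n) → δᶜ₃ a b b ≡ 0
  δᶜ₃-zeroʳ a b rewrite ≡⇒δᶜ≡0 {b} {b} refl | *-zeroʳ (δᶜ a b) = *-zeroʳ (δᶜ a b)

  δᶜ₃-distinctˡ : {a b c : Card n} → a ≢ b → a ≢ c → δᶜ₃ a b c ≡ δᶜ b c
  δᶜ₃-distinctˡ {b = b} {c} a≢b a≢c rewrite ≢⇒δᶜ≡1 a≢b | ≢⇒δᶜ≡1 a≢c = trans (+-identityʳ _) (*-identityˡ (δᶜ b c))

  δᶜ₃-distinctᵐ : {a b c : Card n} → a ≢ b → b ≢ c → δᶜ₃ a b c ≡ δᶜ a c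
  δᶜ₃-distinctᵐ {a} {c = c} a≢b b≢c rewrite ≢⇒δᶜ≡1 a≢b | ≢⇒δᶜ≡1 b≢c =
    trans (+-identityʳ (δᶜ a c * 1)) (*-identityʳ (δᶜ a c))

  δᶜ₃-distinctʳ : {a b c : Card n} → a ≢ c → b ≢ c → δᶜ₃ a b c ≡ δᶜ a b
  δᶜ₃-distinctʳ {a} {b} a≢c b≢c rewrite ≢⇒δᶜ≡1 a≢c | ≢⇒δᶜ≡1 b≢c = *-identityʳ (δᶜ a b)

∑ : List A → (A → ℕ) → ℕ
∑ []      f = 0
∑ (x ∷ L) f = f x + ∑ L f

module _ {A : Set} where

  ∑-cong : ∀ (L : List A) {f g} → (∀ x → f x ≡ g x) → ∑ L f ≡ ∑ L g
  ∑-cong []      e = refl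
  ∑-cong (x ∷ L) e = cong₂ _+_ (e x) (∑-cong L e)

  ∑-cong∈ : ∀ (L : List A) {f g} → (∀ {x} → x ∈ L → f x ≡ g x) → ∑ L f ≡ ∑ L g
  ∑-cong∈ []      e = refl
  ∑-cong∈ (x ∷ L) e = cong₂ _+_ (e (here refl)) (∑-cong∈ L (λ x∈L → e (there x∈L)))

  ∑-zero : ∀ (L : List A) {f} → (∀ x → f x ≡ 0) → ∑ L f ≡ 0
  ∑-zero []      e = refl
  ∑-zero (x ∷ L) e rewrite e x = ∑-zero L e

  ∑-const1 : ∀ (L : List A) → ∑ L (λ _ → 1) ≡ length L
  ∑-const1 []      = refl
  ∑-const1 (x ∷ L) = cong suc (∑-const1 L)

  ∑-+ : ∀ (L : List A) f g → ∑ L (λ x → f x + g x) ≡ ∑ L f + ∑ L g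
  ∑-+ []      f g = refl
  ∑-+ (x ∷ L) f g = trans (cong (_+_ (f x + g x)) (∑-+ L f g)) (+-+-comm (f x) (g x) _ _)
    where
      +-+-comm : ∀ a b c d → (a + b) + (c + d) ≡ (a + c) + (b + d)
      +-+-comm = solve-∀

  ∑-*ˡ : ∀ (L : List A) k f → ∑ L (λ x → k * f x) ≡ k * ∑ L f
  ∑-*ˡ []      k f = sym (*-zeroʳ k)
  ∑-*ˡ (x ∷ L) k f = trans (cong (_+_ (k * f x)) (∑-*ˡ L k f)) (sym (*-distribˡ-+ k (f x) _))

  ∑-*ʳ : ∀ (L : List A) k f → ∑ L (λ x → f x * k) ≡ ∑ L f * k
  ∑-*ʳ []      k f = refl
  ∑-*ʳ (x ∷ L) k f = trans (cong (_+_ (f x * k)) (∑-*ʳ L k f)) (sym (*-distribʳ-+ k (f x) _))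

  ∑-++ : ∀ (L M : List A) f → ∑ (L ++ M) f ≡ ∑ L f + ∑ M f
  ∑-++ []      M f = refl
  ∑-++ (x ∷ L) M f = trans (cong (_+_ (f x)) (∑-++ L M f)) (sym (+-assoc (f x) _ _))

  ∑-map : ∀ {B : Set} (g : B → A) (L : List B) f → ∑ (map g L) f ≡ ∑ L (λ x → f (g x))
  ∑-map g []      f = refl
  ∑-map g (x ∷ L) f = cong (_+_ (f (g x))) (∑-map g L f)

  ∑-filter : ∀ {P : A → Set} (P? : ∀ x → Dec (P x)) L → length (filter P? L) ≡ ∑ L (λ x → ⟦ P? x ⟧)
  ∑-filter P? []      = refl
  ∑-filter P? (x ∷ L) with P? x
  ... | yes _ = cong suc (∑-filter P? L)
  ... | no _  = ∑-filter P? L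

∑-swap : (L : List A) (M : List B) (f : A → B → ℕ) →
         ∑ L (λ x → ∑ M (f x)) ≡ ∑ M (λ y → ∑ L (λ x → f x y))
∑-swap []      M f = sym (∑-zero M (λ _ → refl))
∑-swap (x ∷ L) M f =
  trans (cong (_+_ (∑ M (f x))) (∑-swap L M f)) (sym (∑-+ M (f x) (λ y → ∑ L (λ x′ → f x′ y))))

∑² : List A → (A → A → ℕ) → ℕ
∑² L h = ∑ L (λ b → ∑ L (h b))

∑³ : List A → (A → A → A → ℕ) → ℕ
∑³ L G = ∑ L (λ a → ∑² L (G a))

module _ {A : Set} where

  ∑²-+ : ∀ L (h k : A → A → ℕ) → ∑² L (λ b c → h b c + k b c) ≡ ∑² L h + ∑² L k
  ∑²-+ L h k = trans (∑-cong L (λ b → ∑-+ L (h b) (k b))) (∑-+ L (λ b → ∑ L (h b)) (λ b → ∑ L (k b)))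

  ∑³-+ : ∀ L (h k : A → A → A → ℕ) → ∑³ L (λ a b c → h a b c + k a b c) ≡ ∑³ L h + ∑³ L k
  ∑³-+ L h k = trans (∑-cong L (λ a → ∑²-+ L (h a) (k a))) (∑-+ L (λ a → ∑² L (h a)) (λ a → ∑² L (k a)))

  ∑³-cong : ∀ L {h k : A → A → A → ℕ} → (∀ a b c → h a b c ≡ k a b c) → ∑³ L h ≡ ∑³ L k
  ∑³-cong L e = ∑-cong L (λ a → ∑-cong L (λ b → ∑-cong L (e a b)))

  ∑³-*ˡ : ∀ L k (h : A → A → A → ℕ) → ∑³ L (λ a b c → k * h a b c) ≡ k * ∑³ L h
  ∑³-*ˡ L k h = trans (∑-cong L (λ a → trans (∑-cong L (λ b → ∑-*ˡ L k (h a b))) (∑-*ˡ L k (λ b → ∑ L (h a b)))))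
                      (∑-*ˡ L k (λ a → ∑² L (h a)))

  ∑³-product : ∀ L (f₁ f₂ f₃ : A → ℕ) → ∑³ L (λ a b c → f₁ a * (f₂ b * f₃ c)) ≡ ∑ L f₁ * (∑ L f₂ * ∑ L f₃)
  ∑³-product L f₁ f₂ f₃ = begin
      ∑³ L (λ a b c → f₁ a * (f₂ b * f₃ c))
        ≡⟨ ∑-cong L (λ a → ∑-cong L (λ b → trans (∑-*ˡ L (f₁ a) (λ c → f₂ b * f₃ c)) (cong (f₁ a *_) (∑-*ˡ L (f₂ b) f₃)))) ⟩
      ∑ L (λ a → ∑ L (λ b → f₁ a * (f₂ b * ∑ L f₃)))
        ≡⟨ ∑-cong L (λ a → trans (∑-*ˡ L (f₁ a) (λ b → f₂ b * ∑ L f₃)) (cong (f₁ a *_) (∑-*ʳ L (∑ L f₃) f₂))) ⟩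
      ∑ L (λ a → f₁ a * (∑ L f₂ * ∑ L f₃))
        ≡⟨ ∑-*ʳ L (∑ L f₂ * ∑ L f₃) f₁ ⟩
      ∑ L f₁ * (∑ L f₂ * ∑ L f₃) ∎
    where open ≡-Reasoning

  ∑²-∷ : ∀ y L (h : A → A → ℕ) →
         ∑² (y ∷ L) h ≡ (h y y + ∑ L (h y)) + (∑ L (λ b → h b y) + ∑² L h)
  ∑²-∷ y L h = cong (_+_ (h y y + ∑ L (h y))) (∑-+ L (λ b → h b y) (λ b → ∑ L (h b)))

  ∑³-∷ : ∀ y L (G : A → A → A → ℕ) →
    ∑³ (y ∷ L) G ≡
      ((G y y y + ∑ L (G y y)) + (∑ L (λ b → G y b y) + ∑² L (G y)))
      + ((∑ L (λ a → G a y y) + ∑² L (λ a c → G a y c)) + (∑² L (λ a b → G a b y) + ∑³ L G))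
  ∑³-∷ y L G = cong₂ _+_ (∑²-∷ y L (G y))
    (trans (∑-cong L (λ a → ∑²-∷ y L (G a)))
     (trans (∑-+ L (λ a → G a y y + ∑ L (G a y)) (λ a → ∑ L (λ b → G a b y) + ∑² L (G a)))
       (cong₂ _+_ (∑-+ L (λ a → G a y y) (λ a → ∑ L (G a y)))
                  (∑-+ L (λ a → ∑ L (λ b → G a b y)) (λ a → ∑² L (G a))))))

module _ {n : ℕ} where

  𝟙 : List (Card n) → Card n → ℕ
  𝟙 L v = ∑ L (λ c → δ c v)

  ∑-δ : ∀ L v (g : Card n → ℕ) → ∑ L (λ a → δ a v * g a) ≡ 𝟙 L v * g v
  ∑-δ []      v g = refl
  ∑-δ (x ∷ L) v g with x ≟c v
  ... | yes refl = trans (cong (_+_ (1 * g x)) (∑-δ L x g)) (sym (*-distribʳ-+ (g x) 1 (𝟙 L x)))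
  ... | no _     = ∑-δ L v g

  ∉⇒𝟙≡0 : ∀ {L v} → v ∉ L → 𝟙 L v ≡ 0
  ∉⇒𝟙≡0 {[]}    _   = refl
  ∉⇒𝟙≡0 {x ∷ L} v∉L rewrite ≢⇒δ≡0 (λ x≡v → v∉L (here (sym x≡v))) = ∉⇒𝟙≡0 (λ v∈L → v∉L (there v∈L))

  ∈⇒𝟙≡1 : ∀ {L v} → Unique L → v ∈ L → 𝟙 L v ≡ 1
  ∈⇒𝟙≡1 {x ∷ L} (x∉L ∷ _) (here refl) =
    cong₂ _+_ (≡⇒δ≡1 {a = x} refl) (∉⇒𝟙≡0 (λ x∈L → All.lookup x∉L x∈L refl))
  ∈⇒𝟙≡1 {x ∷ L} (x∉L ∷ uL) (there v∈L) rewrite ≢⇒δ≡0 (All.lookup x∉L v∈L) = ∈⇒𝟙≡1 uL v∈L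

  ∑-δ-collapse : ∀ {T a} → Unique T → a ∈ T → (g : Card n → ℕ) → ∑ T (λ b → δ a b * g b) ≡ g a
  ∑-δ-collapse {T} {a} uT a∈T g = begin
    ∑ T (λ b → δ a b * g b) ≡⟨ ∑-cong T (λ b → cong (_* g b) (δ-sym a b)) ⟩
    ∑ T (λ b → δ b a * g b) ≡⟨ ∑-δ T a g ⟩
    𝟙 T a * g a             ≡⟨ cong (_* g a) (∈⇒𝟙≡1 uT a∈T) ⟩
    1 * g a                 ≡⟨ *-identityˡ (g a) ⟩
    g a                     ∎
    where open ≡-Reasoning

  ∑-𝟙 : ∀ {T Y} → Unique T → Y ⊆ T → (g : Card n → ℕ) → ∑ T (λ a → 𝟙 Y a * g a) ≡ ∑ Y g
  ∑-𝟙 {T} {Y} uT Y⊆T g = begin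
    ∑ T (λ a → 𝟙 Y a * g a)               ≡⟨ ∑-cong T (λ a → sym (∑-*ʳ Y (g a) (λ y → δ y a))) ⟩
    ∑ T (λ a → ∑ Y (λ y → δ y a * g a))   ≡⟨ ∑-swap T Y (λ a y → δ y a * g a) ⟩
    ∑ Y (λ y → ∑ T (λ a → δ y a * g a))   ≡⟨ ∑-cong∈ Y (λ y∈Y → ∑-δ-collapse uT (Y⊆T y∈Y) g) ⟩
    ∑ Y g                                 ∎
    where open ≡-Reasoning

  ∑-involution : ∀ {T} → Unique T → (σ : Card n → Card n) → (∀ c → σ (σ c) ≡ c) →
                 (∀ {c} → c ∈ T → σ c ∈ T) → (g : Card n → ℕ) → ∑ T (λ c → g (σ c)) ≡ ∑ T g
  ∑-involution {T} uT σ σσ≗id σ-closed g = begin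
      ∑ T (λ c → g (σ c))                     ≡⟨ ∑-cong∈ T (λ c∈T → sym (𝟙σ* c∈T _)) ⟩
      ∑ T (λ c → 𝟙 T (σ c) * g (σ c))         ≡⟨ ∑-cong T (λ c → sym (∑-δ T (σ c) g)) ⟩
      ∑ T (λ c → ∑ T (λ d → δ d (σ c) * g d)) ≡⟨ ∑-swap T T (λ c d → δ d (σ c) * g d) ⟩
      ∑ T (λ d → ∑ T (λ c → δ d (σ c) * g d))
        ≡⟨ ∑-cong T (λ d → ∑-cong T (λ c → cong (_* g d) (δ-cong (σ-flip d c) (σ-flip c d)))) ⟩
      ∑ T (λ d → ∑ T (λ c → δ c (σ d) * g d)) ≡⟨ ∑-cong T (λ d → ∑-*ʳ T (g d) (λ c → δ c (σ d))) ⟩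
      ∑ T (λ d → 𝟙 T (σ d) * g d)             ≡⟨ ∑-cong∈ T (λ d∈T → 𝟙σ* d∈T _) ⟩
      ∑ T g                                   ∎
    where
      open ≡-Reasoning
      σ-flip : ∀ d c → d ≡ σ c → c ≡ σ d
      σ-flip d c d≡σc = trans (sym (σσ≗id c)) (cong σ (sym d≡σc))
      𝟙σ* : ∀ {d} → d ∈ T → ∀ k → 𝟙 T (σ d) * k ≡ k
      𝟙σ* d∈T k = trans (cong (_* k) (∈⇒𝟙≡1 uT (σ-closed d∈T))) (*-identityˡ k)

  #sumTo : ℕ → Card n → List (Card n) → ℕ
  #sumTo k z L = ∑ (choose k L) (λ T → ⟦ sumCards T ≟c z ⟧)

  quads≡#sumTo4 : (S : CardSet n) → quads S ≡ #sumTo 4 𝟎 (elems S)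
  quads≡#sumTo4 S = ∑-filter (λ T → sumCards T ≟c 𝟎) (choose 4 (elems S))

  #sumTo-∷ : ∀ k z x L → #sumTo (suc k) z (x ∷ L) ≡ #sumTo k (x ⊕ z) L + #sumTo (suc k) z L
  #sumTo-∷ k z x L = begin
      #sumTo (suc k) z (x ∷ L)
        ≡⟨ ∑-++ (map (x ∷_) (choose k L)) (choose (suc k) L) _ ⟩
      ∑ (map (x ∷_) (choose k L)) (λ T → ⟦ sumCards T ≟c z ⟧) + #sumTo (suc k) z L
        ≡⟨ cong (_+ #sumTo (suc k) z L) (∑-map (x ∷_) (choose k L) _) ⟩
      ∑ (choose k L) (λ T → ⟦ (x ⊕ sumCards T) ≟c z ⟧) + #sumTo (suc k) z L
        ≡⟨ cong (_+ #sumTo (suc k) z L) (∑-cong (choose k L) (λ T → ⟦⟧-cong (_ ≟c z) (_ ≟c (x ⊕ z))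
             (λ e → ≡⊕⇒≡⊕ (sym e)) (λ e → trans (cong (x ⊕_) e) (⊕-cancelˡ x z)))) ⟩
      #sumTo k (x ⊕ z) L + #sumTo (suc k) z L ∎
    where open ≡-Reasoning

  #sumTo-1 : ∀ z L → #sumTo 1 z L ≡ 𝟙 L z
  #sumTo-1 z []      = refl
  #sumTo-1 z (x ∷ L) = trans (#sumTo-∷ 0 z x L) (cong₂ _+_ (trans (+-identityʳ _) x⊕z) (#sumTo-1 z L))
    where
      x⊕z : δ 𝟎 (x ⊕ z) ≡ δ x z
      x⊕z = δ-cong (λ e → ⊕≡𝟎⇒≡ (sym e)) (λ e → sym (trans (cong (x ⊕_) (sym e)) (⊕-self x)))

  ∑³-∷-δᶜ₃ : ∀ y L (h : Card n → Card n → Card n → ℕ) →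
    ∑³ (y ∷ L) (λ a b c → δᶜ₃ a b c * h a b c) ≡
      ∑² L (λ b c → δᶜ₃ y b c * h y b c) + (∑² L (λ a c → δᶜ₃ a y c * h a y c)
        + (∑² L (λ a b → δᶜ₃ a b y * h a b y) + ∑³ L (λ a b c → δᶜ₃ a b c * h a b c)))
  ∑³-∷-δᶜ₃ y L h = trans (∑³-∷ y L G)
      (cong₂ _+_ (cong₂ _+_ (cong₂ _+_ (Gaac y y) (∑-zero L (Gaac y))) (cong (_+ ∑² L (G y)) (∑-zero L (Gaba y))))
                 (cong (_+ (∑² L (λ a b → G a b y) + ∑³ L G))
                       (cong (_+ ∑² L (λ a c → G a y c)) (∑-zero L (λ a → Gabb a y)))))
    where
      G : Card n → Card n → Card n → ℕ
      G a b c = δᶜ₃ a b c * h a b c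
      Gaac : ∀ a c → G a a c ≡ 0
      Gaac a c = cong (_* h a a c) (δᶜ₃-zeroˡ a c)
      Gaba : ∀ a b → G a b a ≡ 0
      Gaba a b = cong (_* h a b a) (δᶜ₃-zeroᵐ a b)
      Gabb : ∀ a b → G a b b ≡ 0
      Gabb a b = cong (_* h a b b) (δᶜ₃-zeroʳ a b)

  ordPairs : Card n → List (Card n) → ℕ
  ordPairs w L = ∑ L (λ c → 𝟙 L (w ⊕ c))

  ordTriples : Card n → List (Card n) → ℕ
  ordTriples x L = ∑³ L (λ a b c → δᶜ₃ a b c * δ x (a ⊕ (b ⊕ c)))

  ordQuads : List (Card n) → ℕ
  ordQuads L = ∑³ L (λ a b c → δᶜ₃ a b c * 𝟙 L (a ⊕ (b ⊕ c)))

  ordPairs≡2*#sumTo2 : ∀ (w : Card n) L → w ≢ 𝟎 → ordPairs w L ≡ 2 * #sumTo 2 w L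
  ordPairs≡2*#sumTo2 w []      w≢𝟎 = refl
  ordPairs≡2*#sumTo2 w (y ∷ L) w≢𝟎 = begin
      (δ y (w ⊕ y) + 𝟙 L (w ⊕ y)) + ∑ L (λ c → δ y (w ⊕ c) + 𝟙 L (w ⊕ c))
        ≡⟨ cong₂ _+_ (cong (_+ 𝟙 L (w ⊕ y)) (≢⇒δ≡0 (≢𝟎⇒≢⊕ y w≢𝟎))) (∑-+ L (λ c → δ y (w ⊕ c)) (λ c → 𝟙 L (w ⊕ c))) ⟩
      𝟙 L (w ⊕ y) + (∑ L (λ c → δ y (w ⊕ c)) + ordPairs w L)
        ≡⟨ cong (λ t → 𝟙 L (w ⊕ y) + (t + ordPairs w L)) (∑-cong L (λ c → δ-cong ≡⊕⇒≡⊕ ≡⊕⇒≡⊕)) ⟩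
      𝟙 L (w ⊕ y) + (𝟙 L (w ⊕ y) + ordPairs w L)
        ≡⟨ cong (λ t → 𝟙 L (w ⊕ y) + (𝟙 L (w ⊕ y) + t)) (ordPairs≡2*#sumTo2 w L w≢𝟎) ⟩
      𝟙 L (w ⊕ y) + (𝟙 L (w ⊕ y) + 2 * #sumTo 2 w L)
        ≡⟨ arith (𝟙 L (w ⊕ y)) (#sumTo 2 w L) ⟩
      2 * (𝟙 L (w ⊕ y) + #sumTo 2 w L)
        ≡⟨ cong (λ v → 2 * (v + #sumTo 2 w L)) (trans (cong (𝟙 L) (⊕-comm w y)) (sym (#sumTo-1 (y ⊕ w) L))) ⟩
      2 * (#sumTo 1 (y ⊕ w) L + #sumTo 2 w L)
        ≡⟨ cong (2 *_) (sym (#sumTo-∷ 1 w y L)) ⟩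
      2 * #sumTo 2 w (y ∷ L) ∎
    where
      open ≡-Reasoning
      arith : ∀ o c → o + (o + 2 * c) ≡ 2 * (o + c)
      arith = solve-∀

  δᶜ*δ⊕≡δ : ∀ {w : Card n} b c → w ≢ 𝟎 → δᶜ b c * δ c (w ⊕ b) ≡ δ c (w ⊕ b)
  δᶜ*δ⊕≡δ {w} b c w≢𝟎 with c ≟c (w ⊕ b)
  ... | no _  = *-zeroʳ (δᶜ b c)
  ... | yes e rewrite ≢⇒δᶜ≡1 (λ b≡c → ≢𝟎⇒≢⊕ b w≢𝟎 (trans b≡c e)) = refl

  ordTriples≡6*#sumTo3 : ∀ x L → Unique L → All (x ≢_) L → ordTriples x L ≡ 6 * #sumTo 3 x L
  ordTriples≡6*#sumTo3 x []      _          _            = refl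
  ordTriples≡6*#sumTo3 x (y ∷ L) (y∉L ∷ uL) (x≢y ∷ x∉L) = begin
      ordTriples x (y ∷ L)
        ≡⟨ ∑³-∷-δᶜ₃ y L (λ a b c → δ x (a ⊕ (b ⊕ c))) ⟩
      ∑² L (λ b c → G y b c) + (∑² L (λ a c → G a y c) + (∑² L (λ a b → G a b y) + ordTriples x L))
        ≡⟨ cong₂ _+_ (∑²-pairs Gybc)
             (cong₂ _+_ (∑²-pairs Gayc) (cong₂ _+_ (∑²-pairs Gaby) (ordTriples≡6*#sumTo3 x L uL x∉L))) ⟩
      2 * #sumTo 2 w L + (2 * #sumTo 2 w L + (2 * #sumTo 2 w L + 6 * #sumTo 3 x L))
        ≡⟨ arith (#sumTo 2 w L) (#sumTo 3 x L) ⟩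
      6 * (#sumTo 2 w L + #sumTo 3 x L)
        ≡⟨ cong (6 *_) (sym (#sumTo-∷ 2 x y L)) ⟩
      6 * #sumTo 3 x (y ∷ L) ∎
    where
      open ≡-Reasoning
      w = y ⊕ x
      G : Card n → Card n → Card n → ℕ
      G a b c = δᶜ₃ a b c * δ x (a ⊕ (b ⊕ c))
      arith : ∀ c₂ c₃ → 2 * c₂ + (2 * c₂ + (2 * c₂ + 6 * c₃)) ≡ 6 * (c₂ + c₃)
      arith = solve-∀
      reduce : ∀ b c → δᶜ b c * δ x (y ⊕ (b ⊕ c)) ≡ δ c (w ⊕ b)
      reduce b c = trans (cong (δᶜ b c *_) (δ-cong ⊕-rotate ⊕-rotate⁻)) (δᶜ*δ⊕≡δ b c (≢⇒⊕≢𝟎 x≢y))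
      ∑²-pairs : {g : Card n → Card n → ℕ} → (∀ {b c} → b ∈ L → c ∈ L → g b c ≡ δ c (w ⊕ b)) →
                 ∑² L g ≡ 2 * #sumTo 2 w L
      ∑²-pairs g≡ = trans (∑-cong∈ L (λ b∈L → ∑-cong∈ L (g≡ b∈L)))
                          (ordPairs≡2*#sumTo2 w L (≢⇒⊕≢𝟎 x≢y))
      y≢ : ∀ {b} → b ∈ L → y ≢ b
      y≢ = All.lookup y∉L
      Gybc : ∀ {b c} → b ∈ L → c ∈ L → G y b c ≡ δ c (w ⊕ b)
      Gybc {b} {c} b∈L c∈L = trans (cong (_* δ x (y ⊕ (b ⊕ c))) (δᶜ₃-distinctˡ (y≢ b∈L) (y≢ c∈L))) (reduce b c)
      Gayc : ∀ {a c} → a ∈ L → c ∈ L → G a y c ≡ δ c (w ⊕ a)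
      Gayc {a} {c} a∈L c∈L = trans (cong₂ _*_ (δᶜ₃-distinctᵐ (y≢ a∈L ∘ sym) (y≢ c∈L)) (cong (δ x) (⊕-leftComm a y c)))
                                   (reduce a c)
      Gaby : ∀ {a b} → a ∈ L → b ∈ L → G a b y ≡ δ b (w ⊕ a)
      Gaby {a} {b} a∈L b∈L = trans (cong₂ _*_ (δᶜ₃-distinctʳ (y≢ a∈L ∘ sym) (y≢ b∈L ∘ sym))
                                              (cong (δ x) (trans (cong (a ⊕_) (⊕-comm b y)) (⊕-leftComm a y b))))
                                   (reduce a b)

  ∑²δᶜ𝟙≡ordTriples : ∀ x L → All (x ≢_) L → ∑² L (λ b c → δᶜ b c * 𝟙 L (x ⊕ (b ⊕ c))) ≡ ordTriples x L
  ∑²δᶜ𝟙≡ordTriples x L x∉L = begin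
      ∑² L (λ b c → δᶜ b c * 𝟙 L (x ⊕ (b ⊕ c)))
        ≡⟨ ∑-cong∈ L (λ {b} b∈L → ∑-cong∈ L (λ {c} c∈L →
             trans (sym (∑-*ˡ L (δᶜ b c) (λ a → δ a (x ⊕ (b ⊕ c))))) (∑-cong L (pointwise b∈L c∈L)))) ⟩
      ∑ L (λ b → ∑ L (λ c → ∑ L (λ a → G a b c)))
        ≡⟨ ∑-cong L (λ b → ∑-swap L L (λ c a → G a b c)) ⟩
      ∑ L (λ b → ∑ L (λ a → ∑ L (G a b)))
        ≡⟨ ∑-swap L L (λ b a → ∑ L (G a b)) ⟩
      ordTriples x L ∎
    where
      open ≡-Reasoning
      G : Card n → Card n → Card n → ℕ
      G a b c = δᶜ₃ a b c * δ x (a ⊕ (b ⊕ c))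
      x≢ : ∀ {b} → b ∈ L → x ≢ b
      x≢ = All.lookup x∉L
      pointwise : ∀ {b c} → b ∈ L → c ∈ L → ∀ a → δᶜ b c * δ a (x ⊕ (b ⊕ c)) ≡ G a b c
      pointwise {b} {c} b∈L c∈L a with a ≟c (x ⊕ (b ⊕ c))
      ... | no a≢ = trans (*-zeroʳ (δᶜ b c))
                      (sym (trans (cong (δᶜ₃ a b c *_) (≢⇒δ≡0 (a≢ ∘ ≡⊕-exchange))) (*-zeroʳ (δᶜ₃ a b c))))
      ... | yes refl = trans (*-identityʳ (δᶜ b c))
                         (sym (trans (cong₂ _*_ (δᶜ₃-distinctˡ a≢b a≢c) (≡⇒δ≡1 (sym (⊕-cancelʳ x (b ⊕ c)))))
                                     (*-identityʳ (δᶜ b c))))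
        where
          a≢b : x ⊕ (b ⊕ c) ≢ b
          a≢b e = x≢ c∈L (a⊕[b⊕c]≡a⇒b≡c (trans (sym (⊕-leftComm x b c)) e))
          a≢c : x ⊕ (b ⊕ c) ≢ c
          a≢c e = x≢ b∈L (a⊕[b⊕c]≡a⇒b≡c (trans (sym (trans (cong (x ⊕_) (⊕-comm b c)) (⊕-leftComm x c b))) e))

  δᶜ*δ[x⊕[b⊕c]]≡0 : ∀ (x b c : Card n) → δᶜ b c * δ x (x ⊕ (b ⊕ c)) ≡ 0
  δᶜ*δ[x⊕[b⊕c]]≡0 x b c with b ≟c c
  ... | yes _  = refl
  ... | no b≢c rewrite ≢⇒δ≡0 {a = x} {b = x ⊕ (b ⊕ c)} (λ e → b≢c (a⊕[b⊕c]≡a⇒b≡c (sym e))) = refl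

  ordQuads≡24*#sumTo4 : ∀ L → Unique L → ordQuads L ≡ 24 * #sumTo 4 𝟎 L
  ordQuads≡24*#sumTo4 []      _          = refl
  ordQuads≡24*#sumTo4 (x ∷ L) (x∉L ∷ uL) = begin
      ordQuads (x ∷ L)
        ≡⟨ ∑³-∷-δᶜ₃ x L (λ a b c → 𝟙 (x ∷ L) (a ⊕ (b ⊕ c))) ⟩
      ∑² L (λ b c → G x b c) + (∑² L (λ a c → G a x c) + (∑² L (λ a b → G a b x) + ∑³ L G))
        ≡⟨ cong₂ _+_ (triples Gxbc) (cong₂ _+_ (triples Gaxc) (cong₂ _+_ (triples Gabx) split)) ⟩
      6 * c₃ + (6 * c₃ + (6 * c₃ + (6 * c₃ + 24 * c₄)))
        ≡⟨ arith c₃ c₄ ⟩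
      24 * (#sumTo 3 x L + c₄)
        ≡⟨ cong (λ v → 24 * (#sumTo 3 v L + c₄)) (sym (⊕-identityʳ x)) ⟩
      24 * (#sumTo 3 (x ⊕ 𝟎) L + c₄)
        ≡⟨ cong (24 *_) (sym (#sumTo-∷ 3 𝟎 x L)) ⟩
      24 * #sumTo 4 𝟎 (x ∷ L) ∎
    where
      open ≡-Reasoning
      c₃ = #sumTo 3 x L
      c₄ = #sumTo 4 𝟎 L
      G : Card n → Card n → Card n → ℕ
      G a b c = δᶜ₃ a b c * 𝟙 (x ∷ L) (a ⊕ (b ⊕ c))
      arith : ∀ c₃ c₄ → 6 * c₃ + (6 * c₃ + (6 * c₃ + (6 * c₃ + 24 * c₄))) ≡ 24 * (c₃ + c₄)
      arith = solve-∀
      x≢ : ∀ {b} → b ∈ L → x ≢ b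
      x≢ = All.lookup x∉L
      triples : {g : Card n → Card n → ℕ} → (∀ {b c} → b ∈ L → c ∈ L → g b c ≡ δᶜ b c * 𝟙 L (x ⊕ (b ⊕ c))) →
                ∑² L g ≡ 6 * c₃
      triples g≡ = trans (∑-cong∈ L (λ b∈L → ∑-cong∈ L (g≡ b∈L)))
                         (trans (∑²δᶜ𝟙≡ordTriples x L x∉L) (ordTriples≡6*#sumTo3 x L uL x∉L))
      drop-x : ∀ b c → δᶜ b c * 𝟙 (x ∷ L) (x ⊕ (b ⊕ c)) ≡ δᶜ b c * 𝟙 L (x ⊕ (b ⊕ c))
      drop-x b c = trans (*-distribˡ-+ (δᶜ b c) (δ x (x ⊕ (b ⊕ c))) _)
                         (cong (_+ δᶜ b c * 𝟙 L (x ⊕ (b ⊕ c))) (δᶜ*δ[x⊕[b⊕c]]≡0 x b c))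
      Gxbc : ∀ {b c} → b ∈ L → c ∈ L → G x b c ≡ δᶜ b c * 𝟙 L (x ⊕ (b ⊕ c))
      Gxbc {b} {c} b∈L c∈L =
        trans (cong (_* 𝟙 (x ∷ L) (x ⊕ (b ⊕ c))) (δᶜ₃-distinctˡ (x≢ b∈L) (x≢ c∈L))) (drop-x b c)
      Gaxc : ∀ {a c} → a ∈ L → c ∈ L → G a x c ≡ δᶜ a c * 𝟙 L (x ⊕ (a ⊕ c))
      Gaxc {a} {c} a∈L c∈L =
        trans (cong₂ _*_ (δᶜ₃-distinctᵐ (x≢ a∈L ∘ sym) (x≢ c∈L)) (cong (𝟙 (x ∷ L)) (⊕-leftComm a x c))) (drop-x a c)
      Gabx : ∀ {a b} → a ∈ L → b ∈ L → G a b x ≡ δᶜ a b * 𝟙 L (x ⊕ (a ⊕ b))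
      Gabx {a} {b} a∈L b∈L =
        trans (cong₂ _*_ (δᶜ₃-distinctʳ (x≢ a∈L ∘ sym) (x≢ b∈L ∘ sym))
                         (cong (𝟙 (x ∷ L)) (trans (cong (a ⊕_) (⊕-comm b x)) (⊕-leftComm a x b))))
              (drop-x a b)
      split : ∑³ L G ≡ 6 * c₃ + 24 * c₄
      split = trans (∑³-cong L (λ a b c → *-distribˡ-+ (δᶜ₃ a b c) (δ x (a ⊕ (b ⊕ c))) (𝟙 L (a ⊕ (b ⊕ c)))))
                    (trans (∑³-+ L _ _) (cong₂ _+_ (ordTriples≡6*#sumTo3 x L uL x∉L) (ordQuads≡24*#sumTo4 L uL)))

module _ {n : ℕ} where

  _∈?_ : (v : Card n) (L : List (Card n)) → Dec (v ∈ L)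
  v ∈? L = any? (v ≟c_) L

  _∖_ : CardSet n → CardSet n → CardSet n
  (T , uT) ∖ (X , _) = filter (λ v → ¬? (v ∈? X)) T , filter⁺ (λ v → ¬? (v ∈? X)) uT

  ∖-⊆ : ∀ T X → elems (T ∖ X) ⊆ elems T
  ∖-⊆ (T , _) (X , _) v∈T∖X = proj₁ (∈-filter⁻ (λ v → ¬? (v ∈? X)) v∈T∖X)

  ∖-∉ : ∀ T X {v} → v ∈ elems (T ∖ X) → v ∉ elems X
  ∖-∉ (T , _) (X , _) v∈T∖X = proj₂ (∈-filter⁻ (λ v → ¬? (v ∈? X)) {xs = T} v∈T∖X)

  𝟙+𝟙∖≡1 : ∀ T X {a} → a ∈ elems T → 𝟙 (elems X) a + 𝟙 (elems (T ∖ X)) a ≡ 1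
  𝟙+𝟙∖≡1 T X {a} a∈T with a ∈? elems X
  ... | yes a∈X = cong₂ _+_ (∈⇒𝟙≡1 (proj₂ X) a∈X) (∉⇒𝟙≡0 (λ a∈T∖X → ∖-∉ T X a∈T∖X a∈X))
  ... | no a∉X  = cong₂ _+_ (∉⇒𝟙≡0 a∉X) (∈⇒𝟙≡1 (proj₂ (T ∖ X)) (a∈T∖X T X a∈T a∉X))
    where
      a∈T∖X : ∀ T X → a ∈ elems T → a ∉ elems X → a ∈ elems (T ∖ X)
      a∈T∖X (T , _) (X , _) = ∈-filter⁺ (λ v → ¬? (v ∈? X))

  𝟙*𝟙∖≡0 : ∀ T X a → 𝟙 (elems X) a * 𝟙 (elems (T ∖ X)) a ≡ 0
  𝟙*𝟙∖≡0 T X a with a ∈? elems X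
  ... | yes a∈X rewrite ∉⇒𝟙≡0 (λ a∈T∖X → ∖-∉ T X a∈T∖X a∈X) = *-zeroʳ (𝟙 (elems X) a)
  ... | no a∉X  rewrite ∉⇒𝟙≡0 a∉X = refl

  𝟙*𝟙≡𝟙 : ∀ {Y} → Unique Y → ∀ a → 𝟙 Y a * 𝟙 Y a ≡ 𝟙 Y a
  𝟙*𝟙≡𝟙 {Y} uY a with a ∈? Y
  ... | yes a∈Y rewrite ∈⇒𝟙≡1 uY a∈Y = refl
  ... | no a∉Y  rewrite ∉⇒𝟙≡0 a∉Y = refl

  ∑𝟙≡length : ∀ {T Y : List (Card n)} → Unique T → Y ⊆ T → ∑ T (𝟙 Y) ≡ length Y
  ∑𝟙≡length {T} {Y} uT Y⊆T =
    trans (∑-cong T (λ a → sym (*-identityʳ (𝟙 Y a)))) (trans (∑-𝟙 uT Y⊆T (λ _ → 1)) (∑-const1 Y))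

  size-∖ : ∀ T X → elems X ⊆ elems T → size X + size (T ∖ X) ≡ size T
  size-∖ T X X⊆T = begin
      size X + size (T ∖ X)
        ≡⟨ sym (cong₂ _+_ (∑𝟙≡length (proj₂ T) X⊆T) (∑𝟙≡length (proj₂ T) (∖-⊆ T X))) ⟩
      ∑ (elems T) (𝟙 (elems X)) + ∑ (elems T) (𝟙 (elems (T ∖ X)))
        ≡⟨ sym (∑-+ (elems T) _ _) ⟩
      ∑ (elems T) (λ a → 𝟙 (elems X) a + 𝟙 (elems (T ∖ X)) a)
        ≡⟨ ∑-cong∈ (elems T) (𝟙+𝟙∖≡1 T X) ⟩
      ∑ (elems T) (λ _ → 1)
        ≡⟨ ∑-const1 (elems T) ⟩
      size T ∎
    where open ≡-Reasoning

-- Weighted sums over the quads of a complete set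

⊕-closed : ∀ {n} (T : CardSet n) → Complete T → ∀ {a b c} →
           a ∈ elems T → b ∈ elems T → c ∈ elems T → (a ⊕ (b ⊕ c)) ∈ elems T
⊕-closed T complete {a} {b} {c} a∈T b∈T c∈T with a ≟c b | a ≟c c | b ≟c c
... | yes refl | _        | _        = subst (_∈ elems T) (sym (⊕-cancelˡ a c)) c∈T
... | no _     | yes refl | _        = subst (_∈ elems T) (sym (trans (cong (a ⊕_) (⊕-comm b a)) (⊕-cancelˡ a b))) b∈T
... | no _     | no _     | yes refl = subst (_∈ elems T) (sym (trans (cong (a ⊕_) (⊕-self b)) (⊕-identityʳ a))) a∈T
... | no a≢b   | no a≢c   | no b≢c   = complete a b c a∈T b∈T c∈T a≢b a≢c b≢c

module _ {n : ℕ} where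

  -- Over a complete set, (a, b, c, a ⊕ (b ⊕ c)) runs through the ordered quads.
  quadSum : List (Card n) → (f₁ f₂ f₃ f₄ : Card n → ℕ) → ℕ
  quadSum T f₁ f₂ f₃ f₄ = ∑³ T (λ a b c → δᶜ₃ a b c * (f₁ a * (f₂ b * (f₃ c * f₄ (a ⊕ (b ⊕ c))))))

  quadSum-swap₁₂ : ∀ T f₁ f₂ f₃ f₄ → quadSum T f₁ f₂ f₃ f₄ ≡ quadSum T f₂ f₁ f₃ f₄
  quadSum-swap₁₂ T f₁ f₂ f₃ f₄ = trans (∑-swap T T (λ a b → ∑ T (λ c → term a b c)))
      (∑-cong T (λ b → ∑-cong T (λ a → ∑-cong T (λ c → pointwise a b c))))
    where
      term : Card n → Card n → Card n → ℕ
      term a b c = δᶜ₃ a b c * (f₁ a * (f₂ b * (f₃ c * f₄ (a ⊕ (b ⊕ c)))))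
      arith : ∀ x y z u v w t → x * (y * z) * (u * (v * (w * t))) ≡ x * (z * y) * (v * (u * (w * t)))
      arith = solve-∀
      pointwise : ∀ a b c → term a b c ≡ δᶜ₃ b a c * (f₂ b * (f₁ a * (f₃ c * f₄ (b ⊕ (a ⊕ c)))))
      pointwise a b c rewrite δᶜ-sym a b | ⊕-leftComm a b c =
        arith (δᶜ b a) (δᶜ a c) (δᶜ b c) (f₁ a) (f₂ b) (f₃ c) (f₄ (b ⊕ (a ⊕ c)))

  quadSum-swap₂₃ : ∀ T f₁ f₂ f₃ f₄ → quadSum T f₁ f₂ f₃ f₄ ≡ quadSum T f₁ f₃ f₂ f₄
  quadSum-swap₂₃ T f₁ f₂ f₃ f₄ = ∑-cong T (λ a → trans (∑-swap T T (term a))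
      (∑-cong T (λ c → ∑-cong T (λ b → pointwise a b c))))
    where
      term : Card n → Card n → Card n → ℕ
      term a b c = δᶜ₃ a b c * (f₁ a * (f₂ b * (f₃ c * f₄ (a ⊕ (b ⊕ c)))))
      arith : ∀ x y z u v w t → x * (y * z) * (u * (v * (w * t))) ≡ y * (x * z) * (u * (w * (v * t)))
      arith = solve-∀
      pointwise : ∀ a b c → term a b c ≡ δᶜ₃ a c b * (f₁ a * (f₃ c * (f₂ b * f₄ (a ⊕ (c ⊕ b)))))
      pointwise a b c rewrite δᶜ-sym b c | ⊕-comm b c =
        arith (δᶜ a b) (δᶜ a c) (δᶜ c b) (f₁ a) (f₂ b) (f₃ c) (f₄ (a ⊕ (c ⊕ b)))

  -- c ↦ a ⊕ (b ⊕ c) permutes a complete set and exchanges the third and fourth card of a quad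
  quadSum-swap₃₄ : ∀ (T : CardSet n) → Complete T → ∀ f₁ f₂ f₃ f₄ →
                   quadSum (elems T) f₁ f₂ f₃ f₄ ≡ quadSum (elems T) f₁ f₂ f₄ f₃
  quadSum-swap₃₄ T@(L , uL) complete f₁ f₂ f₃ f₄ = ∑-cong∈ L (λ {a} a∈T → ∑-cong∈ L (λ {b} b∈T →
      trans (∑-cong L (pointwise a b))
            (∑-involution uL (λ c → a ⊕ (b ⊕ c)) (involutive a b) (⊕-closed T complete a∈T b∈T) (term₄₃ a b))))
    where
      term₄₃ : Card n → Card n → Card n → ℕ
      term₄₃ a b c = δᶜ₃ a b c * (f₁ a * (f₂ b * (f₄ c * f₃ (a ⊕ (b ⊕ c)))))
      involutive : ∀ a b c → a ⊕ (b ⊕ (a ⊕ (b ⊕ c))) ≡ c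
      involutive a b c = trans (cong (a ⊕_) (trans (⊕-leftComm b a (b ⊕ c)) (cong (a ⊕_) (⊕-cancelˡ b c)))) (⊕-cancelˡ a c)
      δᶜ-shiftˡ : ∀ a b c → δᶜ a (a ⊕ (b ⊕ c)) ≡ δᶜ b c
      δᶜ-shiftˡ a b c = cong (1 ∸_) (δ-cong
        (λ e → a⊕[b⊕c]≡a⇒b≡c (sym e))
        (λ e → sym (trans (cong (λ v → a ⊕ (v ⊕ c)) e) (trans (cong (a ⊕_) (⊕-self c)) (⊕-identityʳ a)))))
      δᶜ-shiftʳ : ∀ a b c → δᶜ b (a ⊕ (b ⊕ c)) ≡ δᶜ a c
      δᶜ-shiftʳ a b c = trans (cong (δᶜ b) (⊕-leftComm a b c)) (δᶜ-shiftˡ b a c)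
      arith : ∀ x y z u v w t → x * (y * z) * (u * (v * (w * t))) ≡ x * (z * y) * (u * (v * (t * w)))
      arith = solve-∀
      pointwise : ∀ a b c → δᶜ₃ a b c * (f₁ a * (f₂ b * (f₃ c * f₄ (a ⊕ (b ⊕ c))))) ≡ term₄₃ a b (a ⊕ (b ⊕ c))
      pointwise a b c rewrite δᶜ-shiftˡ a b c | δᶜ-shiftʳ a b c | involutive a b c =
        arith (δᶜ a b) (δᶜ a c) (δᶜ b c) (f₁ a) (f₂ b) (f₃ c) (f₄ (a ⊕ (b ⊕ c)))

  δᶜ₃+δ+δ+δ≡1+2δδ : (a b c : Card n) → δᶜ₃ a b c + (δ a b + (δ a c + δ b c)) ≡ 1 + 2 * (δ a b * δ b c)
  δᶜ₃+δ+δ+δ≡1+2δδ a b c with a ≟c b | a ≟c c | b ≟c c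
  ... | yes _   | yes _   | yes _   = refl
  ... | yes a≡b | yes a≡c | no b≢c  = ⊥-elim (b≢c (trans (sym a≡b) a≡c))
  ... | yes a≡b | no a≢c  | yes b≡c = ⊥-elim (a≢c (trans a≡b b≡c))
  ... | yes _   | no _    | no _    = refl
  ... | no a≢b  | yes a≡c | yes b≡c = ⊥-elim (a≢b (trans a≡c (sym b≡c)))
  ... | no _    | yes _   | no _    = refl
  ... | no _    | no _    | yes _   = refl
  ... | no _    | no _    | no _    = refl

  module _ {T : List (Card n)} (uT : Unique T) (f₁ f₂ f₃ : Card n → ℕ) where

    private
      w : Card n → Card n → Card n → ℕ
      w a b c = f₁ a * (f₂ b * f₃ c)

    ∑³-δ₁₂ : ∑³ T (λ a b c → δ a b * w a b c) ≡ ∑ T (λ a → f₁ a * f₂ a) * ∑ T f₃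
    ∑³-δ₁₂ = begin
        ∑³ T (λ a b c → δ a b * w a b c)
          ≡⟨ ∑-cong∈ T (λ {a} a∈T → trans (∑-cong T (λ b → ∑-*ˡ T (δ a b) (w a b)))
                                          (∑-δ-collapse uT a∈T (λ b → ∑ T (w a b)))) ⟩
        ∑ T (λ a → ∑ T (w a a))
          ≡⟨ ∑-cong T (λ a → trans (∑-cong T (λ c → sym (*-assoc (f₁ a) (f₂ a) (f₃ c)))) (∑-*ˡ T (f₁ a * f₂ a) f₃)) ⟩
        ∑ T (λ a → f₁ a * f₂ a * ∑ T f₃)
          ≡⟨ ∑-*ʳ T (∑ T f₃) (λ a → f₁ a * f₂ a) ⟩
        ∑ T (λ a → f₁ a * f₂ a) * ∑ T f₃ ∎
      where open ≡-Reasoning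

    ∑³-δ₁₃ : ∑³ T (λ a b c → δ a c * w a b c) ≡ ∑ T (λ a → f₁ a * f₃ a) * ∑ T f₂
    ∑³-δ₁₃ = begin
        ∑³ T (λ a b c → δ a c * w a b c)
          ≡⟨ ∑-cong∈ T (λ {a} a∈T → ∑-cong T (λ b → ∑-δ-collapse uT a∈T (w a b))) ⟩
        ∑ T (λ a → ∑ T (λ b → f₁ a * (f₂ b * f₃ a)))
          ≡⟨ ∑-cong T (λ a → trans (∑-cong T (λ b → arith (f₁ a) (f₂ b) (f₃ a))) (∑-*ˡ T (f₁ a * f₃ a) f₂)) ⟩
        ∑ T (λ a → f₁ a * f₃ a * ∑ T f₂)
          ≡⟨ ∑-*ʳ T (∑ T f₂) (λ a → f₁ a * f₃ a) ⟩
        ∑ T (λ a → f₁ a * f₃ a) * ∑ T f₂ ∎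
      where
        open ≡-Reasoning
        arith : ∀ x y z → x * (y * z) ≡ x * z * y
        arith = solve-∀

    ∑³-δ₂₃ : ∑³ T (λ a b c → δ b c * w a b c) ≡ ∑ T f₁ * ∑ T (λ a → f₂ a * f₃ a)
    ∑³-δ₂₃ = begin
        ∑³ T (λ a b c → δ b c * w a b c)
          ≡⟨ ∑-cong T (λ a → ∑-cong∈ T (λ {b} b∈T → ∑-δ-collapse uT b∈T (w a b))) ⟩
        ∑ T (λ a → ∑ T (λ b → f₁ a * (f₂ b * f₃ b)))
          ≡⟨ ∑-cong T (λ a → ∑-*ˡ T (f₁ a) (λ b → f₂ b * f₃ b)) ⟩
        ∑ T (λ a → f₁ a * ∑ T (λ b → f₂ b * f₃ b))
          ≡⟨ ∑-*ʳ T (∑ T (λ b → f₂ b * f₃ b)) f₁ ⟩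
        ∑ T f₁ * ∑ T (λ a → f₂ a * f₃ a) ∎
      where open ≡-Reasoning

    ∑³-δ₁₂δ₂₃ : ∑³ T (λ a b c → δ a b * (δ b c * w a b c)) ≡ ∑ T (λ a → f₁ a * (f₂ a * f₃ a))
    ∑³-δ₁₂δ₂₃ = ∑-cong∈ T (λ {a} a∈T → trans
      (∑-cong∈ T (λ {b} b∈T → trans (∑-*ˡ T (δ a b) (λ c → δ b c * w a b c))
                                    (cong (δ a b *_) (∑-δ-collapse uT b∈T (w a b)))))
      (∑-δ-collapse uT a∈T (λ b → w a b b)))

    quadSum-inclusion-exclusion :
      quadSum T f₁ f₂ f₃ (λ _ → 1)
        + (∑ T (λ a → f₁ a * f₂ a) * ∑ T f₃ + (∑ T (λ a → f₁ a * f₃ a) * ∑ T f₂ + ∑ T f₁ * ∑ T (λ a → f₂ a * f₃ a)))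
      ≡ ∑ T f₁ * (∑ T f₂ * ∑ T f₃) + 2 * ∑ T (λ a → f₁ a * (f₂ a * f₃ a))
    quadSum-inclusion-exclusion = begin
        quadSum T f₁ f₂ f₃ (λ _ → 1)
          + (∑ T (λ a → f₁ a * f₂ a) * ∑ T f₃ + (∑ T (λ a → f₁ a * f₃ a) * ∑ T f₂ + ∑ T f₁ * ∑ T (λ a → f₂ a * f₃ a)))
          ≡⟨ cong₂ _+_ (∑³-cong T (λ a b c → cong (λ t → δᶜ₃ a b c * (f₁ a * (f₂ b * t))) (*-identityʳ (f₃ c))))
                       (sym (cong₂ _+_ ∑³-δ₁₂ (cong₂ _+_ ∑³-δ₁₃ ∑³-δ₂₃))) ⟩
        ∑³ T (λ a b c → δᶜ₃ a b c * w a b c)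
          + (∑³ T (λ a b c → δ a b * w a b c) + (∑³ T (λ a b c → δ a c * w a b c) + ∑³ T (λ a b c → δ b c * w a b c)))
          ≡⟨ sym (∑³-+₄ _ _ _ _) ⟩
        ∑³ T (λ a b c → δᶜ₃ a b c * w a b c + (δ a b * w a b c + (δ a c * w a b c + δ b c * w a b c)))
          ≡⟨ ∑³-cong T pointwise ⟩
        ∑³ T (λ a b c → w a b c + 2 * (δ a b * (δ b c * w a b c)))
          ≡⟨ ∑³-+ T w _ ⟩
        ∑³ T w + ∑³ T (λ a b c → 2 * (δ a b * (δ b c * w a b c)))
          ≡⟨ cong₂ _+_ (∑³-product T f₁ f₂ f₃) (trans (∑³-*ˡ T 2 _) (cong (2 *_) ∑³-δ₁₂δ₂₃)) ⟩
        ∑ T f₁ * (∑ T f₂ * ∑ T f₃) + 2 * ∑ T (λ a → f₁ a * (f₂ a * f₃ a)) ∎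
      where
        open ≡-Reasoning
        ∑³-+₄ : ∀ h₁ h₂ h₃ h₄ → ∑³ T (λ a b c → h₁ a b c + (h₂ a b c + (h₃ a b c + h₄ a b c)))
                                ≡ ∑³ T h₁ + (∑³ T h₂ + (∑³ T h₃ + ∑³ T h₄))
        ∑³-+₄ h₁ h₂ h₃ h₄ = trans (∑³-+ T h₁ _)
          (cong (_+_ (∑³ T h₁)) (trans (∑³-+ T h₂ _) (cong (_+_ (∑³ T h₂)) (∑³-+ T h₃ h₄))))
        factor : ∀ d x y z v → d * v + (x * v + (y * v + z * v)) ≡ (d + (x + (y + z))) * v
        factor = solve-∀
        expand : ∀ x z v → (1 + 2 * (x * z)) * v ≡ v + 2 * (x * (z * v))
        expand = solve-∀
        pointwise : ∀ a b c → δᶜ₃ a b c * w a b c + (δ a b * w a b c + (δ a c * w a b c + δ b c * w a b c))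
                              ≡ w a b c + 2 * (δ a b * (δ b c * w a b c))
        pointwise a b c = trans (factor (δᶜ₃ a b c) (δ a b) (δ a c) (δ b c) (w a b c))
          (trans (cong (_* w a b c) (δᶜ₃+δ+δ+δ≡1+2δδ a b c)) (expand (δ a b) (δ b c) (w a b c)))

  quadSum-𝟙 : ∀ {T Y} → Unique T → Unique Y → Y ⊆ T →
              quadSum T (𝟙 Y) (𝟙 Y) (𝟙 Y) (𝟙 Y) ≡ 24 * #sumTo 4 𝟎 Y
  quadSum-𝟙 {T} {Y} uT uY Y⊆T = begin
      quadSum T s s s s
        ≡⟨ ∑³-cong T (λ a b c → move (δᶜ₃ a b c) (s a) (s b) (s c) (s (a ⊕ (b ⊕ c)))) ⟩
      ∑³ T (λ a b c → s a * (s b * (s c * h a b c)))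
        ≡⟨ ∑-cong T (λ a → ∑-cong T (λ b → trans (∑-*ˡ T (s a) _) (cong (s a *_) (trans (∑-*ˡ T (s b) _)
             (cong (s b *_) (∑-𝟙 uT Y⊆T (h a b))))))) ⟩
      ∑ T (λ a → ∑ T (λ b → s a * (s b * ∑ Y (h a b))))
        ≡⟨ ∑-cong T (λ a → trans (∑-*ˡ T (s a) _) (cong (s a *_) (∑-𝟙 uT Y⊆T (λ b → ∑ Y (h a b))))) ⟩
      ∑ T (λ a → s a * ∑² Y (h a))
        ≡⟨ ∑-𝟙 uT Y⊆T (λ a → ∑² Y (h a)) ⟩
      ordQuads Y
        ≡⟨ ordQuads≡24*#sumTo4 Y uY ⟩
      24 * #sumTo 4 𝟎 Y ∎
    where
      open ≡-Reasoning
      s : Card n → ℕ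
      s = 𝟙 Y
      h : Card n → Card n → Card n → ℕ
      h a b c = δᶜ₃ a b c * s (a ⊕ (b ⊕ c))
      move : ∀ d x y z t → d * (x * (y * (z * t))) ≡ x * (y * (z * (d * t)))
      move = solve-∀

-- Quads of a subset and of its complement

2*nC2+n≡n*n : ∀ n → 2 * (n C 2) + n ≡ n * n
2*nC2+n≡n*n zero    = refl
2*nC2+n≡n*n (suc n) = begin
    2 * (suc n C 2) + suc n         ≡⟨ cong (λ t → 2 * t + suc n) (sym (nCk+nC[k+1]≡[n+1]C[k+1] n 1)) ⟩
    2 * (n C 1 + n C 2) + suc n     ≡⟨ cong (λ t → 2 * (t + n C 2) + suc n) (nC1≡n n) ⟩
    2 * (n + n C 2) + suc n         ≡⟨ expand n (n C 2) ⟩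
    (2 * (n C 2) + n) + (2 * n + 1) ≡⟨ cong (_+ (2 * n + 1)) (2*nC2+n≡n*n n) ⟩
    n * n + (2 * n + 1)             ≡⟨ square n ⟩
    suc n * suc n                   ∎
  where
    open ≡-Reasoning
    expand : ∀ n c → 2 * (n + c) + suc n ≡ (2 * c + n) + (2 * n + 1)
    expand = solve-∀
    square : ∀ n → n * n + (2 * n + 1) ≡ suc n * suc n
    square = solve-∀

6*nC3+3*n*n≡n*n*n+2*n : ∀ n → 6 * (n C 3) + 3 * (n * n) ≡ n * (n * n) + 2 * n
6*nC3+3*n*n≡n*n*n+2*n zero    = refl
6*nC3+3*n*n≡n*n*n+2*n (suc n) = +-cancelʳ-≡ (n * n + n) _ _ (begin
    6 * (suc n C 3) + 3 * (suc n * suc n) + (n * n + n)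
      ≡⟨ cong (λ t → 6 * t + 3 * (suc n * suc n) + (n * n + n)) (sym (nCk+nC[k+1]≡[n+1]C[k+1] n 2)) ⟩
    6 * (n C 2 + n C 3) + 3 * (suc n * suc n) + (n * n + n)
      ≡⟨ expand n (n C 2) (n C 3) ⟩
    (6 * (n C 3) + 3 * (n * n)) + 3 * (2 * (n C 2) + n) + (3 * n + 3 + n * n + n)
      ≡⟨ cong₂ (λ u v → u + 3 * v + (3 * n + 3 + n * n + n)) (6*nC3+3*n*n≡n*n*n+2*n n) (2*nC2+n≡n*n n) ⟩
    (n * (n * n) + 2 * n) + 3 * (n * n) + (3 * n + 3 + n * n + n)
      ≡⟨ cube n ⟩
    suc n * (suc n * suc n) + 2 * suc n + (n * n + n) ∎)
  where
    open ≡-Reasoning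
    expand : ∀ n c₂ c₃ → 6 * (c₂ + c₃) + 3 * (suc n * suc n) + (n * n + n)
                         ≡ (6 * c₃ + 3 * (n * n)) + 3 * (2 * c₂ + n) + (3 * n + 3 + n * n + n)
    expand = solve-∀
    cube : ∀ n → (n * (n * n) + 2 * n) + 3 * (n * n) + (3 * n + 3 + n * n + n)
                 ≡ suc n * (suc n * suc n) + 2 * suc n + (n * n + n)
    cube = solve-∀

φ : ℕ → ℕ → ℕ
φ p q = 3 * (p C 3) + p * (q C 2)

private
  ordered-sss : ∀ {e m} → e + (m * m + (m * m + m * m)) ≡ m * (m * m) + 2 * m → e ≡ 6 * (m C 3)
  ordered-sss {e} {m} h = +-cancelʳ-≡ (3 * (m * m)) e (6 * (m C 3))
      (trans (cong (_+_ e) (triple m)) (trans h (sym (6*nC3+3*n*n≡n*n*n+2*n m))))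
    where
      triple : ∀ m → 3 * (m * m) ≡ m * m + (m * m + m * m)
      triple = solve-∀

  ordered-ssc : ∀ {e p q} → e + (p * q + (0 * p + p * 0)) ≡ p * (p * q) + 2 * 0 → e ≡ q * (2 * (p C 2))
  ordered-ssc {e} {p} {q} h = +-cancelʳ-≡ (p * q) e (q * (2 * (p C 2))) (begin
      e + p * q                          ≡⟨ drop-zeros ⟨
      e + (p * q + (0 * p + p * 0))      ≡⟨ h ⟩
      p * (p * q) + 0                    ≡⟨ +-identityʳ (p * (p * q)) ⟩
      p * (p * q)                        ≡⟨ *-assoc p p q ⟨
      p * p * q                          ≡⟨ cong (_* q) (2*nC2+n≡n*n p) ⟨
      (2 * (p C 2) + p) * q              ≡⟨ *-distribʳ-+ q (2 * (p C 2)) p ⟩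
      2 * (p C 2) * q + p * q            ≡⟨ cong (_+ p * q) (*-comm (2 * (p C 2)) q) ⟩
      q * (2 * (p C 2)) + p * q          ∎)
    where
      open ≡-Reasoning
      drop-zeros : e + (p * q + (0 * p + p * 0)) ≡ e + p * q
      drop-zeros = trans (cong (λ t → e + (p * q + t)) (*-zeroʳ p)) (cong (_+_ e) (+-identityʳ (p * q)))

  ordered-scc : ∀ {e p q} → e + (0 * q + (0 * q + p * q)) ≡ p * (q * q) + 2 * 0 → e ≡ p * (2 * (q C 2))
  ordered-scc {e} {p} {q} h = +-cancelʳ-≡ (p * q) e (p * (2 * (q C 2))) (begin
      e + p * q                   ≡⟨ h ⟩
      p * (q * q) + 0             ≡⟨ +-identityʳ (p * (q * q)) ⟩
      p * (q * q)                 ≡⟨ cong (p *_) (2*nC2+n≡n*n q) ⟨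
      p * (2 * (q C 2) + q)       ≡⟨ *-distribˡ-+ p (2 * (q C 2)) q ⟩
      p * (2 * (q C 2)) + p * q   ∎)
    where open ≡-Reasoning

  -- b, c and d count the quads with exactly three, two and one cards in X (6, 4 and 6 times each).
  alternating-sum : ∀ {x y P₃ P₂ Q₂ Q₃ p q b c d} →
    6 * P₃ ≡ 24 * x + b → q * (2 * P₂) ≡ b + c → p * (2 * Q₂) ≡ c + d → 6 * Q₃ ≡ d + 24 * y →
    12 * x + (3 * Q₃ + q * P₂) ≡ 12 * y + (3 * P₃ + p * Q₂)
  alternating-sum {x} {y} {P₃} {P₂} {Q₂} {Q₃} {p} {q} {b} {c} {d} e₁ e₂ e₃ e₄ = *-cancelˡ-≡ _ _ 2 (begin
      2 * (12 * x + (3 * Q₃ + q * P₂))   ≡⟨ double x Q₃ q P₂ ⟩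
      24 * x + (6 * Q₃ + q * (2 * P₂))   ≡⟨ cong₂ (λ u v → 24 * x + (u + v)) e₄ e₂ ⟩
      24 * x + ((d + 24 * y) + (b + c))  ≡⟨ regroup x y b c d ⟩
      24 * y + ((24 * x + b) + (c + d))  ≡⟨ cong₂ (λ u v → 24 * y + (u + v)) e₁ e₃ ⟨
      24 * y + (6 * P₃ + p * (2 * Q₂))   ≡⟨ double y P₃ p Q₂ ⟨
      2 * (12 * y + (3 * P₃ + p * Q₂))   ∎)
    where
      open ≡-Reasoning
      double : ∀ x r s t → 2 * (12 * x + (3 * r + s * t)) ≡ 24 * x + (6 * r + s * (2 * t))
      double = solve-∀
      regroup : ∀ x y b c d → 24 * x + ((d + 24 * y) + (b + c)) ≡ 24 * y + ((24 * x + b) + (c + d))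
      regroup = solve-∀

module _ {n : ℕ} (T : CardSet n) (T-complete : Complete T) (X : CardSet n) (X⊆T : elems X ⊆ elems T) where

  private
    L : List (Card n)
    L = elems T
    s c one : Card n → ℕ
    s = 𝟙 (elems X)
    c = 𝟙 (elems (T ∖ X))
    one _ = 1
    p q : ℕ
    p = size X
    q = size (T ∖ X)
    E : (f₁ f₂ f₃ f₄ : Card n → ℕ) → ℕ
    E = quadSum L

    ∑s : ∑ L s ≡ p
    ∑s = ∑𝟙≡length (proj₂ T) X⊆T
    ∑c : ∑ L c ≡ q
    ∑c = ∑𝟙≡length (proj₂ T) (∖-⊆ T X)
    ss≡s : ∀ a → s a * s a ≡ s a
    ss≡s = 𝟙*𝟙≡𝟙 (proj₂ X)
    cc≡c : ∀ a → c a * c a ≡ c a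
    cc≡c = 𝟙*𝟙≡𝟙 (proj₂ (T ∖ X))
    sc≡0 : ∀ a → s a * c a ≡ 0
    sc≡0 = 𝟙*𝟙∖≡0 T X

    count : ∀ f₁ f₂ f₃ {s₁₂ s₁₃ s₂₃ s₁₂₃ s₁ s₂ s₃} →
      ∑ L (λ a → f₁ a * f₂ a) ≡ s₁₂ → ∑ L (λ a → f₁ a * f₃ a) ≡ s₁₃ → ∑ L (λ a → f₂ a * f₃ a) ≡ s₂₃ →
      ∑ L (λ a → f₁ a * (f₂ a * f₃ a)) ≡ s₁₂₃ → ∑ L f₁ ≡ s₁ → ∑ L f₂ ≡ s₂ → ∑ L f₃ ≡ s₃ →
      E f₁ f₂ f₃ one + (s₁₂ * s₃ + (s₁₃ * s₂ + s₁ * s₂₃)) ≡ s₁ * (s₂ * s₃) + 2 * s₁₂₃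
    count f₁ f₂ f₃ refl refl refl refl refl refl refl = quadSum-inclusion-exclusion (proj₂ T) f₁ f₂ f₃

    E-sss : E s s s one ≡ 6 * (p C 3)
    E-sss = ordered-sss {m = p} (count s s s ∑ss ∑ss ∑ss ∑sss ∑s ∑s ∑s)
      where
        ∑ss = trans (∑-cong L ss≡s) ∑s
        ∑sss = trans (∑-cong L (λ a → trans (cong (s a *_) (ss≡s a)) (ss≡s a))) ∑s

    E-ssc : E s s c one ≡ q * (2 * (p C 2))
    E-ssc = ordered-ssc {p = p} {q} (count s s c (trans (∑-cong L ss≡s) ∑s) ∑sc ∑sc ∑ssc ∑s ∑s ∑c)
      where
        ∑sc = ∑-zero L sc≡0
        ∑ssc = ∑-zero L (λ a → trans (cong (s a *_) (sc≡0 a)) (*-zeroʳ (s a)))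

    E-scc : E s c c one ≡ p * (2 * (q C 2))
    E-scc = ordered-scc {p = p} {q} (count s c c ∑sc ∑sc (trans (∑-cong L cc≡c) ∑c) ∑scc ∑s ∑c ∑c)
      where
        ∑sc = ∑-zero L sc≡0
        ∑scc = ∑-zero L (λ a → trans (cong (s a *_) (cc≡c a)) (sc≡0 a))

    E-ccc : E c c c one ≡ 6 * (q C 3)
    E-ccc = ordered-sss {m = q} (count c c c ∑cc ∑cc ∑cc ∑ccc ∑c ∑c ∑c)
      where
        ∑cc = trans (∑-cong L cc≡c) ∑c
        ∑ccc = trans (∑-cong L (λ a → trans (cong (c a *_) (cc≡c a)) (cc≡c a))) ∑c

    split₄ : ∀ f₁ f₂ f₃ → E f₁ f₂ f₃ one ≡ E f₁ f₂ f₃ s + E f₁ f₂ f₃ c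
    split₄ f₁ f₂ f₃ = trans (∑-cong∈ L (λ a∈T → ∑-cong∈ L (λ b∈T → ∑-cong∈ L (λ c∈T → pointwise a∈T b∈T c∈T))))
                            (∑³-+ L _ _)
      where
        distrib : ∀ d x y z u v → d * (x * (y * (z * (u + v)))) ≡ d * (x * (y * (z * u))) + d * (x * (y * (z * v)))
        distrib = solve-∀
        pointwise : ∀ {a b c′} → a ∈ L → b ∈ L → c′ ∈ L → let d = a ⊕ (b ⊕ c′) in
          δᶜ₃ a b c′ * (f₁ a * (f₂ b * (f₃ c′ * 1)))
            ≡ δᶜ₃ a b c′ * (f₁ a * (f₂ b * (f₃ c′ * s d))) + δᶜ₃ a b c′ * (f₁ a * (f₂ b * (f₃ c′ * c d)))
        pointwise {a} {b} {c′} a∈T b∈T c∈T =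
          trans (cong (λ t → δᶜ₃ a b c′ * (f₁ a * (f₂ b * (f₃ c′ * t))))
                      (sym (𝟙+𝟙∖≡1 T X (⊕-closed T T-complete a∈T b∈T c∈T))))
                (distrib (δᶜ₃ a b c′) (f₁ a) (f₂ b) (f₃ c′) (s (a ⊕ (b ⊕ c′))) (c (a ⊕ (b ⊕ c′))))

    swap₃₄ : ∀ f₁ f₂ f₃ f₄ → E f₁ f₂ f₃ f₄ ≡ E f₁ f₂ f₄ f₃
    swap₃₄ = quadSum-swap₃₄ T T-complete

    E-ssss : E s s s s ≡ 24 * quads X
    E-ssss = trans (quadSum-𝟙 (proj₂ T) (proj₂ X) X⊆T) (cong (24 *_) (sym (quads≡#sumTo4 X)))

    E-cccc : E c c c c ≡ 24 * quads (T ∖ X)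
    E-cccc = trans (quadSum-𝟙 (proj₂ T) (proj₂ (T ∖ X)) (∖-⊆ T X)) (cong (24 *_) (sym (quads≡#sumTo4 (T ∖ X))))

  quads-complement : 12 * quads X + φ (size (T ∖ X)) (size X) ≡ 12 * quads (T ∖ X) + φ (size X) (size (T ∖ X))
  quads-complement = alternating-sum {quads X} {quads (T ∖ X)} {p C 3} {p C 2} {q C 2} {q C 3} {p} {q}
    (begin 6 * (p C 3)           ≡⟨ E-sss ⟨
           E s s s one           ≡⟨ split₄ s s s ⟩
           E s s s s + E s s s c ≡⟨ cong (_+ E s s s c) E-ssss ⟩
           24 * quads X + E s s s c ∎)
    (begin q * (2 * (p C 2))     ≡⟨ E-ssc ⟨
           E s s c one           ≡⟨ split₄ s s c ⟩
           E s s c s + E s s c c ≡⟨ cong (_+ E s s c c) (swap₃₄ s s c s) ⟩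
           E s s s c + E s s c c ∎)
    (begin p * (2 * (q C 2))     ≡⟨ E-scc ⟨
           E s c c one           ≡⟨ split₄ s c c ⟩
           E s c c s + E s c c c ≡⟨ cong (_+ E s c c c) (trans (swap₃₄ s c c s) (quadSum-swap₂₃ L s c s c)) ⟩
           E s s c c + E s c c c ∎)
    (begin 6 * (q C 3)           ≡⟨ E-ccc ⟨
           E c c c one           ≡⟨ split₄ c c c ⟩
           E c c c s + E c c c c ≡⟨ cong₂ _+_ cccs≡sccc E-cccc ⟩
           E s c c c + 24 * quads (T ∖ X) ∎)
    where
      open ≡-Reasoning
      cccs≡sccc : E c c c s ≡ E s c c c
      cccs≡sccc = trans (swap₃₄ c c c s) (trans (quadSum-swap₂₃ L c c s c) (quadSum-swap₁₂ L c s c c))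

quads-complement-sized : ∀ {n} (T : CardSet n) → Complete T → ∀ X → elems X ⊆ elems T → ∀ {p q} →
  size X ≡ p → size (T ∖ X) ≡ q → 12 * quads X + φ q p ≡ 12 * quads (T ∖ X) + φ p q
quads-complement-sized T T-complete X X⊆T refl refl = quads-complement T T-complete X X⊆T

n≤2^⌈log₂n⌉ : ∀ n → n ≤ 2 ^ ⌈log₂ n ⌉
n≤2^⌈log₂n⌉ = <-rec _ step
  where
    step : ∀ n → (∀ {m} → m < n → m ≤ 2 ^ ⌈log₂ m ⌉) → n ≤ 2 ^ ⌈log₂ n ⌉
    step zero          _  = z≤n
    step (suc zero)    _  = s≤s z≤n
    step n@(suc (suc r)) ih = begin
        n                           ≡⟨ ⌊n/2⌋+⌈n/2⌉≡n n ⟨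
        ⌊ n /2⌋ + ⌈ n /2⌉           ≤⟨ +-monoˡ-≤ ⌈ n /2⌉ (⌊n/2⌋≤⌈n/2⌉ n) ⟩
        ⌈ n /2⌉ + ⌈ n /2⌉           ≤⟨ +-mono-≤ half half ⟩
        2 ^ (L ∸ 1) + 2 ^ (L ∸ 1)   ≡⟨ cong (_+_ (2 ^ (L ∸ 1))) (+-identityʳ _) ⟨
        2 ^ (1 + (L ∸ 1))           ≡⟨ cong (2 ^_) (m+[n∸m]≡n 1≤L) ⟩
        2 ^ L                       ∎
      where
        open ≤-Reasoning
        L = ⌈log₂ n ⌉
        1≤L : 1 ≤ L
        1≤L = ⌈log₂⌉-mono-≤ {2} {n} (s≤s (s≤s z≤n))
        half : ⌈ n /2⌉ ≤ 2 ^ (L ∸ 1)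
        half = subst (λ k → ⌈ n /2⌉ ≤ 2 ^ k) (⌈log₂⌈n/2⌉⌉≡⌈log₂n⌉∸1 n) (ih (⌈n/2⌉<n r))

≤2^⇒⌈log₂⌉≤ : ∀ {n k} → n ≤ 2 ^ k → ⌈log₂ n ⌉ ≤ k
≤2^⇒⌈log₂⌉≤ {n} {k} n≤2^k = subst (⌈log₂ n ⌉ ≤_) (⌈log₂2^n⌉≡n k) (⌈log₂⌉-mono-≤ n≤2^k)

⌈log₂⌉-bracket : ∀ n → 2 ≤ n → ∃ λ j → ⌈log₂ n ⌉ ≡ suc j × 2 ^ j < n
⌈log₂⌉-bracket n 2≤n with ⌈log₂ n ⌉ in eq
... | zero  = ⊥-elim (1+n≰n (subst (1 ≤_) eq (⌈log₂⌉-mono-≤ {2} {n} 2≤n)))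
... | suc j = j , refl , ≰⇒> (λ n≤2^j → 1+n≰n (subst (_≤ j) eq (≤2^⇒⌈log₂⌉≤ n≤2^j)))

2^[1+j]∸n<n : ∀ j n → 2 ^ j < n → 2 ^ suc j ∸ n < n
2^[1+j]∸n<n j n 2^j<n = m<n+o⇒m∸n<o (2 ^ suc j) n {{>-nonZero (≤-trans (s≤s z≤n) 2^j<n)}}
  (subst (_< n + n) (cong (_+_ (2 ^ j)) (sym (+-identityʳ (2 ^ j)))) (+-mono-< 2^j<n 2^j<n))

2^[1+j]∸n≤2^j : ∀ j n → 2 ^ j < n → 2 ^ suc j ∸ n ≤ 2 ^ j
2^[1+j]∸n≤2^j j n 2^j<n = m≤n+o⇒m∸n≤o (2 ^ suc j) n
  (subst (_≤ n + 2 ^ j) (cong (_+_ (2 ^ j)) (sym (+-identityʳ (2 ^ j)))) (+-monoˡ-≤ (2 ^ j) (<⇒≤ 2^j<n)))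

-- Packed sets

allCards : (k : ℕ) → List (Card k)
allCards zero    = [] ∷ []
allCards (suc k) = map (false ∷_) (allCards k) ++ map (true ∷_) (allCards k)

∈-allCards : ∀ {k} (v : Card k) → v ∈ allCards k
∈-allCards []               = here refl
∈-allCards {suc k} (false ∷ v) = ∈-++⁺ˡ (∈-map⁺ (false ∷_) (∈-allCards v))
∈-allCards {suc k} (true ∷ v)  = ∈-++⁺ʳ (map (false ∷_) (allCards k)) (∈-map⁺ (true ∷_) (∈-allCards v))

allCards-unique : ∀ k → Unique (allCards k)
allCards-unique zero    = [] ∷ []
allCards-unique (suc k) = ++⁺ (map⁺ ∷-injectiveʳ (allCards-unique k)) (map⁺ ∷-injectiveʳ (allCards-unique k)) disjoint
  where
    disjoint : ∀ {v} → ¬ (v ∈ map (false ∷_) (allCards k) × v ∈ map (true ∷_) (allCards k))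
    disjoint (v∈₀ , v∈₁) with ∈-map⁻ (false ∷_) v∈₀ | ∈-map⁻ (true ∷_) v∈₁
    ... | _ , _ , refl | _ , _ , ()

deck : (k : ℕ) → CardSet k
deck k = allCards k , allCards-unique k

size-deck : ∀ k → size (deck k) ≡ 2 ^ k
size-deck zero    = refl
size-deck (suc k) = begin
    length (map (false ∷_) (allCards k) ++ map (true ∷_) (allCards k))
      ≡⟨ length-++ (map (false ∷_) (allCards k)) ⟩
    length (map (false ∷_) (allCards k)) + length (map (true ∷_) (allCards k))
      ≡⟨ cong₂ _+_ (length-map _ (allCards k)) (length-map _ (allCards k)) ⟩
    length (allCards k) + length (allCards k)
      ≡⟨ cong₂ _+_ (size-deck k) (trans (size-deck k) (sym (+-identityʳ (2 ^ k)))) ⟩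
    2 ^ suc k ∎
  where open ≡-Reasoning

deck-complete : ∀ k → Complete (deck k)
deck-complete k a b c _ _ _ _ _ _ = ∈-allCards (a ⊕ (b ⊕ c))

embed : ∀ {k} → CardSet k → CardSet (suc k)
embed (L , uL) = map (false ∷_) L , map⁺ ∷-injectiveʳ uL

size-embed : ∀ {k} (S : CardSet k) → size (embed S) ≡ size S
size-embed (L , _) = length-map _ L

#sumTo-embed : ∀ {k} j (z : Card k) L → #sumTo j (false ∷ z) (map (false ∷_) L) ≡ #sumTo j z L
#sumTo-embed zero    z L = cong (_+ 0) (⟦⟧-cong (𝟎 ≟c (false ∷ z)) (𝟎 ≟c z) ∷-injectiveʳ (cong (false ∷_)))
#sumTo-embed (suc j) z []      = refl
#sumTo-embed (suc j) z (x ∷ L) = begin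
    #sumTo (suc j) (false ∷ z) (map (false ∷_) (x ∷ L))
      ≡⟨ #sumTo-∷ j (false ∷ z) (false ∷ x) (map (false ∷_) L) ⟩
    #sumTo j (false ∷ (x ⊕ z)) (map (false ∷_) L) + #sumTo (suc j) (false ∷ z) (map (false ∷_) L)
      ≡⟨ cong₂ _+_ (#sumTo-embed j (x ⊕ z) L) (#sumTo-embed (suc j) z L) ⟩
    #sumTo j (x ⊕ z) L + #sumTo (suc j) z L
      ≡⟨ #sumTo-∷ j z x L ⟨
    #sumTo (suc j) z (x ∷ L) ∎
  where open ≡-Reasoning

quads-embed : ∀ {k} (S : CardSet k) → quads (embed S) ≡ quads S
quads-embed S = trans (quads≡#sumTo4 (embed S)) (trans (#sumTo-embed 4 𝟎 (elems S)) (sym (quads≡#sumTo4 S)))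

packed : (k p : ℕ) → CardSet k
packed zero    zero    = [] , []
packed zero    (suc _) = ([] ∷ []) , ([] ∷ [])
packed (suc k) p with p ≤? 2 ^ k
... | yes _ = embed (packed k p)
... | no _  = deck (suc k) ∖ embed (packed k (2 ^ suc k ∸ p))

size-packed : ∀ k p → p ≤ 2 ^ k → size (packed k p) ≡ p
size-packed zero    zero          _         = refl
size-packed zero    (suc zero)    _         = refl
size-packed zero    (suc (suc p)) (s≤s ())
size-packed (suc k) p             p≤2^[1+k] with p ≤? 2 ^ k
... | yes p≤2^k = trans (size-embed (packed k p)) (size-packed k p p≤2^k)
... | no p≰2^k  = begin
    size (deck (suc k) ∖ X)             ≡⟨ m+n∸m≡n (size X) _ ⟨
    size X + size (deck (suc k) ∖ X) ∸ size X
      ≡⟨ cong₂ _∸_ (trans (size-∖ (deck (suc k)) X (λ {v} _ → ∈-allCards v)) (size-deck (suc k))) size-X ⟩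
    2 ^ suc k ∸ (2 ^ suc k ∸ p)         ≡⟨ m∸[m∸n]≡n p≤2^[1+k] ⟩
    p                                   ∎
  where
    open ≡-Reasoning
    X = embed (packed k (2 ^ suc k ∸ p))
    size-X : size X ≡ 2 ^ suc k ∸ p
    size-X = trans (size-embed (packed k (2 ^ suc k ∸ p))) (size-packed k _ (2^[1+j]∸n≤2^j k p (≰⇒> p≰2^k)))

quads-packed-suc : ∀ k p → p ≤ 2 ^ k → quads (packed (suc k) p) ≡ quads (packed k p)
quads-packed-suc k p p≤2^k with p ≤? 2 ^ k
... | yes _    = quads-embed (packed k p)
... | no p≰2^k = ⊥-elim (p≰2^k p≤2^k)

packed-complement : ∀ j p → 2 ^ j < p → packed (suc j) p ≡ deck (suc j) ∖ embed (packed j (2 ^ suc j ∸ p))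
packed-complement j p 2^j<p with p ≤? 2 ^ j
... | yes p≤2^j = ⊥-elim (<⇒≱ 2^j<p p≤2^j)
... | no _      = refl

packedQuads : ℕ → ℕ
packedQuads p = quads (packed ⌈log₂ p ⌉ p)

quads-packed : ∀ k p → ⌈log₂ p ⌉ ≤ k → quads (packed k p) ≡ packedQuads p
quads-packed k p L≤k with m≤n⇒m<n∨m≡n L≤k
... | inj₂ refl = refl
quads-packed (suc k) p _ | inj₁ (s≤s L≤k) =
  trans (quads-packed-suc k p (≤-trans (n≤2^⌈log₂n⌉ p) (^-monoʳ-≤ 2 L≤k))) (quads-packed k p L≤k)

complementSize : ℕ → ℕ
complementSize p = 2 ^ ⌈log₂ p ⌉ ∸ p

complementSize<n : ∀ p → 2 ≤ p → complementSize p < p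
complementSize<n p 2≤p with ⌈log₂⌉-bracket p 2≤p
... | j , L≡1+j , 2^j<p = subst (λ L → 2 ^ L ∸ p < p) (sym L≡1+j) (2^[1+j]∸n<n j p 2^j<p)

packedQuads-recursion : ∀ p → 2 ≤ p → let q = complementSize p in
                        12 * packedQuads p + φ q p ≡ 12 * packedQuads q + φ p q
packedQuads-recursion p 2≤p with ⌈log₂⌉-bracket p 2≤p
... | j , L≡1+j , 2^j<p =
  subst (λ L → 12 * quads (packed L p) + φ (2 ^ L ∸ p) p ≡ 12 * packedQuads (2 ^ L ∸ p) + φ p (2 ^ L ∸ p))
        (sym L≡1+j) recursion
  where
    q = 2 ^ suc j ∸ p
    q≤2^j : q ≤ 2 ^ j
    q≤2^j = 2^[1+j]∸n≤2^j j p 2^j<p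
    X = embed (packed j q)
    size-X : size X ≡ q
    size-X = trans (size-embed (packed j q)) (size-packed j q q≤2^j)
    size-Xᶜ : size (deck (suc j) ∖ X) ≡ p
    size-Xᶜ = trans (cong size (sym (packed-complement j p 2^j<p)))
                    (size-packed (suc j) p (subst (λ L → p ≤ 2 ^ L) L≡1+j (n≤2^⌈log₂n⌉ p)))
    quads-X : quads X ≡ packedQuads q
    quads-X = trans (quads-embed (packed j q)) (quads-packed j q (≤2^⇒⌈log₂⌉≤ q≤2^j))
    recursion : 12 * quads (packed (suc j) p) + φ q p ≡ 12 * packedQuads q + φ p q
    recursion rewrite packed-complement j p 2^j<p = sym (trans (cong (λ x → 12 * x + φ p q) (sym quads-X))
      (quads-complement-sized (deck (suc j)) (deck-complete (suc j)) X (λ {v} _ → ∈-allCards v) size-X size-Xᶜ))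

QuadBound : ℕ → ℕ → Set
QuadBound ℓ m = ∀ n (S : CardSet n) → ℓ ≤ 2 ^ n → size S ≡ ℓ → quads S ≤ m

balanced-≤ : ∀ {x y x′ y′ a b} → 12 * x + a ≡ 12 * y + b → 12 * x′ + a ≡ 12 * y′ + b → y ≤ y′ → x ≤ x′
balanced-≤ {x} {y} {x′} {y′} {a} {b} e e′ y≤y′ = *-cancelˡ-≤ 12 (+-cancelʳ-≤ a (12 * x) (12 * x′) (begin
    12 * x + a   ≡⟨ e ⟩
    12 * y + b   ≤⟨ +-monoˡ-≤ b (*-monoʳ-≤ 12 y≤y′) ⟩
    12 * y′ + b  ≡⟨ e′ ⟨
    12 * x′ + a  ∎))
  where open ≤-Reasoning

quads≤packedQuads-inComplete : ∀ p → 2 ≤ p → QuadBound (complementSize p) (packedQuads (complementSize p)) →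
  ∀ {n} (S T : CardSet n) → p ≤ 2 ^ n → size S ≡ p → size T ≡ 2 ^ ⌈log₂ p ⌉ → Complete T → S ⊆ₛ T →
  quads S ≤ packedQuads p
quads≤packedQuads-inComplete p 2≤p bound {n} S T p≤2^n size-S size-T T-complete S⊆ₛT =
  balanced-≤ (quads-complement-sized T T-complete S S⊆T size-S size-Sᶜ) (packedQuads-recursion p 2≤p)
             (bound n (T ∖ S) q≤2^n size-Sᶜ)
  where
    q = complementSize p
    S⊆T : elems S ⊆ elems T
    S⊆T = All.lookup S⊆ₛT
    size-Sᶜ : size (T ∖ S) ≡ q
    size-Sᶜ = trans (sym (m+n∸m≡n (size S) _)) (cong₂ _∸_ (trans (size-∖ T S S⊆T) size-T) size-S)
    q≤2^n : q ≤ 2 ^ n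
    q≤2^n = ≤-trans (m∸n≤m (2 ^ ⌈log₂ p ⌉) p) (^-monoʳ-≤ 2 (≤2^⇒⌈log₂⌉≤ {p} {n} p≤2^n))

#sumTo-mono-∷ : ∀ {n} k (z x : Card n) L → #sumTo (suc k) z L ≤ #sumTo (suc k) z (x ∷ L)
#sumTo-mono-∷ k z x L = subst (#sumTo (suc k) z L ≤_) (sym (#sumTo-∷ k z x L)) (m≤n+m _ _)

∃-fresh : ∀ {k} (Y : CardSet k) → size Y < 2 ^ k → ∃ λ x → x ∉ elems Y
∃-fresh {k} Y size-Y<2^k with elems (deck k ∖ Y) | size-∖ (deck k) Y (λ {v} _ → ∈-allCards v) | ∖-∉ (deck k) Y
... | []    | size-Y+0≡2^k | _   =
  ⊥-elim (<⇒≢ size-Y<2^k (trans (sym (+-identityʳ (size Y))) (trans size-Y+0≡2^k (size-deck k))))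
... | x ∷ _ | _            | x∉Y = x , x∉Y (here refl)

packedQuads-≤suc : ∀ p → 1 ≤ p → QuadBound (complementSize (suc p)) (packedQuads (complementSize (suc p))) →
                   packedQuads p ≤ packedQuads (suc p)
packedQuads-≤suc p 1≤p bound = extend (∃-fresh Y (subst (_< 2 ^ L) (sym size-Y) p<2^L))
  where
    L = ⌈log₂ suc p ⌉
    Y = packed L p
    p<2^L : p < 2 ^ L
    p<2^L = n≤2^⌈log₂n⌉ (suc p)
    size-Y : size Y ≡ p
    size-Y = size-packed L p (<⇒≤ p<2^L)
    extend : (∃ λ x → x ∉ elems Y) → packedQuads p ≤ packedQuads (suc p)
    extend (x , x∉Y) = begin
        packedQuads p         ≡⟨ quads-packed L p (⌈log₂⌉-mono-≤ (n≤1+n p)) ⟨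
        quads Y               ≡⟨ quads≡#sumTo4 Y ⟩
        #sumTo 4 𝟎 (elems Y)  ≤⟨ #sumTo-mono-∷ 3 𝟎 x (elems Y) ⟩
        #sumTo 4 𝟎 (elems S)  ≡⟨ quads≡#sumTo4 S ⟨
        quads S               ≤⟨ quads≤packedQuads-inComplete (suc p) (s≤s 1≤p) bound S (deck L) p<2^L
                                   (cong suc size-Y) (size-deck L) (deck-complete L)
                                   (All.tabulate (λ {v} _ → ∈-allCards v)) ⟩
        packedQuads (suc p)   ∎
      where
        open ≤-Reasoning
        S : CardSet L
        S = (x ∷ elems Y) , (All.tabulate (λ y∈Y x≡y → x∉Y (subst (_∈ elems Y) (sym x≡y) y∈Y)) ∷ proj₂ Y)

-- Either S lies in a complete set of 2 ^ ⌈log₂ p ⌉ cards, where the complement formula bounds it,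
-- or (H) bounds it by Q(p − 1); deciding the inequality itself avoids deciding which case holds.
packedQuads-isQ : HypH → ∀ p → IsQ p (packedQuads p)
packedQuads-isQ H = <-rec _ λ p ih →
  (⌈log₂ p ⌉ , packed ⌈log₂ p ⌉ p , n≤2^⌈log₂n⌉ p , size-packed ⌈log₂ p ⌉ p (n≤2^⌈log₂n⌉ p) , refl) , bound p ih
  where
    bound : ∀ p → (∀ {m} → m < p → IsQ m (packedQuads m)) → QuadBound p (packedQuads p)
    bound zero            _  _ ([] , _)       _     _      = z≤n
    bound (suc zero)      _  _ ((_ ∷ []) , _) _     _      = z≤n
    bound p@(suc (suc r)) ih n S              p≤2^n size-S with quads S ≤? packedQuads p
    ... | yes ≤packed = ≤packed
    ... | no ≰packed  = ⊥-elim (≰packed (≤-trans viaH (packedQuads-≤suc (suc r) (s≤s z≤n) bound-q)))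
      where
        bound-q : QuadBound (complementSize p) (packedQuads (complementSize p))
        bound-q = proj₂ (ih (complementSize<n p (s≤s (s≤s z≤n))))
        outside : ∀ T → size T ≡ 2 ^ ⌈log₂ p ⌉ → Complete T → ¬ (S ⊆ₛ T)
        outside T size-T T-complete S⊆T = ≰packed
          (quads≤packedQuads-inComplete p (s≤s (s≤s z≤n)) bound-q S T p≤2^n size-S size-T T-complete S⊆T)
        viaH : quads S ≤ packedQuads (suc r)
        viaH = H p (s≤s z≤n) n p≤2^n S size-S outside (packedQuads (suc r)) (ih ≤-refl)

fromℚᵘ-homo-+ : ∀ u v → ℚ.fromℚᵘ u ℚ.+ ℚ.fromℚᵘ v ≡ ℚ.fromℚᵘ (u ℚᵘ.+ v)
fromℚᵘ-homo-+ u v = trans (sym (fromℚᵘ-toℚᵘ _))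
  (fromℚᵘ-cong (ℚᵘ.≃-trans (toℚᵘ-homo-+ (ℚ.fromℚᵘ u) (ℚ.fromℚᵘ v)) (ℚᵘ.+-cong (toℚᵘ-fromℚᵘ u) (toℚᵘ-fromℚᵘ v))))

a/1+i/12≡b/1 : ∀ a b (i : ℤ) → i ℤ.+ + (12 * a) ≡ + (12 * b) → (+ a / 1) ℚ.+ (i / 12) ≡ + b / 1
a/1+i/12≡b/1 a b i h = trans (fromℚᵘ-homo-+ (ℚᵘ.mkℚᵘ (+ a) 0) (ℚᵘ.mkℚᵘ i 11))
  (fromℚᵘ-cong {ℚᵘ.mkℚᵘ (+ a) 0 ℚᵘ.+ ℚᵘ.mkℚᵘ i 11} {ℚᵘ.mkℚᵘ (+ b) 0} (ℚᵘ.*≡* (begin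
    (+ a ℤ.* + 12 ℤ.+ i ℤ.* + 1) ℤ.* + 1  ≡⟨ cross (+ a) i ⟩
    i ℤ.+ + 12 ℤ.* + a                    ≡⟨ cong (ℤ._+_ i) (pos-* 12 a) ⟨
    i ℤ.+ + (12 * a)                      ≡⟨ h ⟩
    + (12 * b)                            ≡⟨ pos-* 12 b ⟩
    + 12 ℤ.* + b                          ≡⟨ twelve-comm (+ b) ⟩
    + b ℤ.* + 12                          ∎)))
  where
    open ≡-Reasoning
    cross : ∀ a i → (a ℤ.* + 12 ℤ.+ i ℤ.* + 1) ℤ.* + 1 ≡ i ℤ.+ + 12 ℤ.* a
    cross = ℤ-Solver.solve-∀
    twelve-comm : ∀ b → + 12 ℤ.* b ≡ b ℤ.* + 12
    twelve-comm = ℤ-Solver.solve-∀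

-- The numerator in the recursion of F; it equals φ p q − φ q p.
Δ : ℕ → ℕ → ℤ
Δ p q = (+ (3 * (p C 3)) ℤ.- + (q * (p C 2))) ℤ.+ (+ (p * (q C 2)) ℤ.- + (3 * (q C 3)))

Δ+y≡x : ∀ {x y} p q → x + φ q p ≡ y + φ p q → Δ p q ℤ.+ + y ≡ + x
Δ+y≡x {x} {y} p q h = begin
    Δ p q ℤ.+ + y                               ≡⟨ gather (+ u) (+ b) (+ v) (+ a) (+ y) ⟩
    ((+ y ℤ.+ (+ u ℤ.+ + v)) ℤ.- + a) ℤ.- + b   ≡⟨ cong (λ t → (t ℤ.- + a) ℤ.- + b) (pos-split y u v) ⟨
    ((+ (y + (u + v))) ℤ.- + a) ℤ.- + b         ≡⟨ cong (λ t → (+ t ℤ.- + a) ℤ.- + b) h ⟨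
    ((+ (x + (a + b))) ℤ.- + a) ℤ.- + b         ≡⟨ cong (λ t → (t ℤ.- + a) ℤ.- + b) (pos-split x a b) ⟩
    ((+ x ℤ.+ (+ a ℤ.+ + b)) ℤ.- + a) ℤ.- + b   ≡⟨ cancel (+ x) (+ a) (+ b) ⟩
    + x                                         ∎
  where
    open ≡-Reasoning
    a = 3 * (q C 3)
    b = q * (p C 2)
    u = 3 * (p C 3)
    v = p * (q C 2)
    pos-split : ∀ x a b → + (x + (a + b)) ≡ + x ℤ.+ (+ a ℤ.+ + b)
    pos-split x a b = trans (pos-+ x (a + b)) (cong (ℤ._+_ (+ x)) (pos-+ a b))
    gather : ∀ u b v a y → ((u ℤ.- b) ℤ.+ (v ℤ.- a)) ℤ.+ y ≡ ((y ℤ.+ (u ℤ.+ v)) ℤ.- a) ℤ.- b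
    gather = ℤ-Solver.solve-∀
    cancel : ∀ x a b → ((x ℤ.+ (a ℤ.+ b)) ℤ.- a) ℤ.- b ≡ x
    cancel = ℤ-Solver.solve-∀

Fᶠ-fuel : ∀ f g p → p ≤ f → p ≤ g → Fᶠ f p ≡ Fᶠ g p
Fᶠ-fuel zero    zero    zero          _     _     = refl
Fᶠ-fuel zero    (suc g) zero          _     _     = refl
Fᶠ-fuel (suc f) zero    zero          _     _     = refl
Fᶠ-fuel (suc f) (suc g) zero          _     _     = refl
Fᶠ-fuel (suc f) (suc g) (suc zero)    _     _     = refl
Fᶠ-fuel (suc f) (suc g) p@(suc (suc _)) p≤1+f p≤1+g =
  cong (ℚ._+ _) (Fᶠ-fuel f g (complementSize p) (≤-pred (≤-trans q<p p≤1+f)) (≤-pred (≤-trans q<p p≤1+g)))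
  where
    q<p : complementSize p < p
    q<p = complementSize<n p (s≤s (s≤s z≤n))

packedQuads≡F : ∀ p → + packedQuads p / 1 ≡ F p
packedQuads≡F = <-rec _ step
  where
    step : ∀ p → (∀ {m} → m < p → + packedQuads m / 1 ≡ F m) → + packedQuads p / 1 ≡ F p
    step zero            _  = refl
    step (suc zero)      _  = refl
    step p@(suc (suc r)) ih = sym (begin
        F p                                            ≡⟨⟩
        Fᶠ (suc r) q ℚ.+ (Δ p q / 12)                  ≡⟨ cong (ℚ._+ (Δ p q / 12)) (Fᶠ-fuel (suc r) q q q≤1+r ≤-refl) ⟩
        F q ℚ.+ (Δ p q / 12)                           ≡⟨ cong (ℚ._+ (Δ p q / 12)) (ih q<p) ⟨
        (+ packedQuads q / 1) ℚ.+ (Δ p q / 12)         ≡⟨ a/1+i/12≡b/1 (packedQuads q) (packedQuads p) (Δ p q)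
                                                            (Δ+y≡x p q (packedQuads-recursion p (s≤s (s≤s z≤n)))) ⟩
        + packedQuads p / 1                            ∎)
      where
        open ≡-Reasoning
        q = complementSize p
        q<p : q < p
        q<p = complementSize<n p (s≤s (s≤s z≤n))
        q≤1+r : q ≤ suc r
        q≤1+r = ≤-pred q<p

mainTheorem8 : HypH → ∀ (ℓ : ℕ) → ∃ λ m → IsQ ℓ m × (+ m / 1) ≡ F ℓ
mainTheorem8 H ℓ = packedQuads ℓ , packedQuads-isQ H ℓ , packedQuads≡F ℓ
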